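{- Let $p$ be a prime with $p\neq 5$. Then $t(p)=2$ if and only if $D_{4p}=30$.
   Context: For an integer $n$, a Toda prime of $n$ is an odd prime $q$ such that $q-1\mid 4n$ and $\gcd\!\left(q,\frac{4n}{q-1}\right)=1$. $T(n)$ denotes the set of Toda primes of $n$, and $t(n):=|T(n)|$. For a positive integer $m$, $D_{2m}$ denotes the denominator (in lowest terms) of the Bernoulli number $B_{2m}$. -}

module Defs where

open import Data.Nat using (ℕ; zero; suc; _∸_; NonZero)
open import Data.Nat.Properties using (*-cancelʳ-≡)
open import Data.Nat.Divisibility using (_∣_; _∣?_; quotient)
open import Data.Nat.GCD using (gcd)
open import Data.Nat.Primality using (Prime; prime?)
open import Data.Nat.Combinatorics using (_C_)
open import Data.Integer using (+_)
open import Data.Rational using (ℚ; 0ℚ; 1ℚ; -_; _/_; _*_; _+_)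
open import Data.List using (List; []; _∷_; [_]; _++_; upTo; filter; length; zipWith; foldr; reverse)
open import Data.Product using (Σ; Σ-syntax; _×_; _,_)
open import Relation.Nullary using (Dec; yes; no; ¬_)
open import Relation.Binary.PropositionalEquality using (_≡_; refl; sym; trans)
import Data.Nat as ℕ

Toda : ℕ → ℕ → Set
Toda n q = Prime q × ¬ (2 ∣ q) × Σ[ d ∈ (q ∸ 1) ∣ 4 ℕ.* n ] gcd q (quotient d) ≡ 1

private
  quot-unique : ∀ {m k} .{{_ : NonZero m}} (d e : m ∣ k) → quotient d ≡ quotient e
  quot-unique {m} d e = *-cancelʳ-≡ (quotient d) (quotient e) m
    (trans (sym (_∣_.equality d)) (_∣_.equality e))

  decGcd : ∀ q {m k} .{{_ : NonZero m}} (d : m ∣ k) →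
           Dec (Σ[ e ∈ m ∣ k ] gcd q (quotient e) ≡ 1)
  decGcd q d with gcd q (quotient d) ℕ.≟ 1
  ... | yes g = yes (d , g)
  ... | no ¬g = no λ { (e , g) → ¬g (trans' g (quot-unique d e)) }
    where
      trans' : ∀ {a b} → gcd q b ≡ 1 → a ≡ b → gcd q a ≡ 1
      trans' g refl = g

toda? : ∀ n q → Dec (Toda n q)
toda? n zero = no λ { (p , _) → Data.Nat.Primality.¬prime[0] p }
toda? n (suc zero) = no λ { (p , _) → Data.Nat.Primality.¬prime[1] p }
toda? n q@(suc (suc r)) with prime? q | 2 ∣? q | suc r ∣? 4 ℕ.* n
... | no ¬p | _ | _ = no λ { (p , _) → ¬p p }
... | yes _ | yes two | _ = no λ { (_ , o , _) → o two }
... | yes _ | no _ | no ¬d = no λ { (_ , _ , d , _) → ¬d d }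
... | yes p | no o | yes d with decGcd q d
...   | yes g = yes (p , o , g)
...   | no ¬g = no λ { (_ , _ , g) → ¬g g }

-- t(n) = |T(n)|.  Every Toda prime q of n satisfies q - 1 ∣ 4n, so for
-- n ≥ 1 it lies in [0, 4n+1]; for n = 0 there are none (gcd(q,0) = q ≠ 1).
t : ℕ → ℕ
t n = length (filter (toda? n) (upTo (4 ℕ.* n ℕ.+ 2)))

-- Bernoulli numbers, via  Σ_{k=0}^{m} C(m+1,k) B_k = 0  (m ≥ 1), B_0 = 1.

private
  ℕtoℚ : ℕ → ℚ
  ℕtoℚ k = (+ k) / 1

  wsum : ℕ → ℕ → List ℚ → ℚ
  wsum N i [] = 0ℚ
  wsum N i (x ∷ xs) = (ℕtoℚ (N C i) * x) + wsum N (suc i) xs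

bernoullis : ℕ → List ℚ
bernoullis zero = [ 1ℚ ]
bernoullis (suc n) = bs ++ [ - ((+ 1 / suc (suc n)) * wsum (suc (suc n)) 0 bs) ]
  where bs = bernoullis n

private
  lastOr : List ℚ → ℚ
  lastOr [] = 0ℚ
  lastOr (x ∷ []) = x
  lastOr (x ∷ y ∷ ys) = lastOr (y ∷ ys)

-- The Bernoulli number B_n (convention B_1 = -1/2).
B : ℕ → ℚ
B n = lastOr (bernoullis n)

D : ℕ → ℕ
D k = ℚ.denominatorℕ (B k)

{-# OPTIONS --safe #-}
-- Von Staudt–Clausen, in local form, comes from Faulhaber's formula
--   Σ_{j<q} j ^ n  =  Σ_{k<n} C(n,k) (q B_k) q ^ (n-k) / (n-k+1)  +  q B_n .
-- By strong induction every q B_k is q-integral, and for even n > 0 every term of the sum lies in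
-- q ℤ₍q₎ (for k = n - 1 the factor is q / 2, and when q = 2 the coefficient C(n, n-1) = n is even),
-- so q B_n ≡ Σ_{j<q} j ^ n, which Fermat's little theorem evaluates to -1 or 0 modulo q according as
-- q - 1 divides n or not.  Hence B_n + Σ_{q prime, q-1 ∣ n} 1/q is an integer.
-- For a prime p ≥ 7 the primes q with q - 1 ∣ 4p are 2, 3, 5 and whichever of 2p + 1, 4p + 1 are
-- prime, while the Toda primes of p are 3, 5 and the same two candidates; so t(p) = 2 and D_{4p} = 30
-- both say that 2p + 1 and 4p + 1 are composite.  The primes p = 2, 3 are settled by computation.
module Submission where

open import Algebra.Bundles using (CommutativeMonoid; Semiring; Ring)

module RangeSum {c ℓ} (M : CommutativeMonoid c ℓ) where

  open import Data.Nat.Base using (ℕ; zero; suc; _∸_; _≤_; _<_; z≤n; s≤s)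
  open import Data.Nat.Properties using (≤-refl; m≤n⇒m≤1+n; m≤n⇒m<n∨m≡n)
  open import Data.Sum.Base using (inj₁; inj₂)
  open import Function.Base using (_∘_)
  open import Relation.Binary.Core using (Rel)
  open import Relation.Unary using (Pred)
  import Relation.Binary.PropositionalEquality.Core as ≡

  open CommutativeMonoid M renaming (Carrier to A)
  open import Algebra.Properties.CommutativeSemigroup commutativeSemigroup using (interchange)
  open import Relation.Binary.Reasoning.Setoid setoid

  Σ : (ℕ → A) → ℕ → A
  Σ f zero = ε
  Σ f (suc n) = Σ f n ∙ f n

  syntax Σ (λ k → e) n = ∑[ k < n ] e

  Σ-preserves : ∀ {r} {R : Rel A r} → R ε ε → (∀ {x y u v} → R x y → R u v → R (x ∙ u) (y ∙ v)) →
                ∀ {f g} n → (∀ k → k < n → R (f k) (g k)) → R (Σ f n) (Σ g n)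
  Σ-preserves R-ε R-∙ zero fRg = R-ε
  Σ-preserves {R = R} R-ε R-∙ {f} {g} (suc n) fRg =
    R-∙ (Σ-preserves {R = R} R-ε R-∙ n (λ k k<n → fRg k (m≤n⇒m≤1+n k<n))) (fRg n ≤-refl)

  Σ-closed : ∀ {p} {P : Pred A p} → P ε → (∀ {x y} → P x → P y → P (x ∙ y)) →
             ∀ {f} n → (∀ k → k < n → P (f k)) → P (Σ f n)
  Σ-closed {P = P} P-ε P-∙ {f} = Σ-preserves {R = λ x _ → P x} P-ε P-∙ {f} {f}

  Σ-cong : ∀ {f g} n → (∀ k → k < n → f k ≈ g k) → Σ f n ≈ Σ g n
  Σ-cong = Σ-preserves {R = _≈_} refl ∙-cong

  Σ-zero : ∀ {f} n → (∀ k → k < n → f k ≈ ε) → Σ f n ≈ ε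
  Σ-zero zero f≈ε = refl
  Σ-zero (suc n) f≈ε = trans (∙-cong (Σ-zero n (λ k k<n → f≈ε k (m≤n⇒m≤1+n k<n))) (f≈ε n ≤-refl)) (identityˡ ε)

  Σ-distrib : ∀ f g n → ∑[ k < n ] (f k ∙ g k) ≈ Σ f n ∙ Σ g n
  Σ-distrib f g zero = sym (identityˡ ε)
  Σ-distrib f g (suc n) = begin
    ∑[ k < n ] (f k ∙ g k) ∙ (f n ∙ g n) ≈⟨ ∙-congʳ (Σ-distrib f g n) ⟩
    (Σ f n ∙ Σ g n) ∙ (f n ∙ g n)        ≈⟨ interchange (Σ f n) (Σ g n) (f n) (g n) ⟩
    (Σ f n ∙ f n) ∙ (Σ g n ∙ g n)        ∎

  Σ-head : ∀ f n → Σ f (suc n) ≈ f 0 ∙ Σ (f ∘ suc) n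
  Σ-head f zero = trans (identityˡ (f 0)) (sym (identityʳ (f 0)))
  Σ-head f (suc n) = trans (∙-congʳ (Σ-head f n)) (assoc (f 0) (Σ (f ∘ suc) n) (f (suc n)))

  Σ-reverse : ∀ f n → Σ f n ≈ ∑[ k < n ] f (n ∸ suc k)
  Σ-reverse f zero = refl
  Σ-reverse f (suc n) = begin
    Σ f n ∙ f n                      ≈⟨ comm (Σ f n) (f n) ⟩
    f n ∙ Σ f n                      ≈⟨ ∙-congˡ (Σ-reverse f n) ⟩
    f n ∙ ∑[ k < n ] f (n ∸ suc k)   ≈⟨ Σ-head (λ k → f (suc n ∸ suc k)) n ⟨
    ∑[ k < suc n ] f (suc n ∸ suc k) ∎

  Σ-comm : ∀ (f : ℕ → ℕ → A) n m → ∑[ k < n ] Σ (f k) m ≈ ∑[ i < m ] ∑[ k < n ] f k i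
  Σ-comm f zero m = sym (Σ-zero m (λ _ _ → refl))
  Σ-comm f (suc n) m = begin
    ∑[ k < n ] Σ (f k) m ∙ Σ (f n) m           ≈⟨ ∙-congʳ (Σ-comm f n m) ⟩
    ∑[ i < m ] ∑[ k < n ] f k i ∙ Σ (f n) m    ≈⟨ Σ-distrib (λ i → ∑[ k < n ] f k i) (f n) m ⟨
    ∑[ i < m ] (∑[ k < n ] f k i ∙ f n i)      ∎

  Σ-extend : ∀ f {n m} → n ≤ m → (∀ k → n ≤ k → f k ≈ ε) → Σ f m ≈ Σ f n
  Σ-extend f {m = zero} z≤n f≈ε = refl
  Σ-extend f {n} {suc m} n≤1+m f≈ε with m≤n⇒m<n∨m≡n n≤1+m
  ... | inj₂ ≡.refl = refl
  ... | inj₁ (s≤s n≤m) = trans (∙-cong (Σ-extend f n≤m f≈ε) (f≈ε m n≤m)) (identityʳ (Σ f n))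

module SemiringRangeSum {c ℓ} (R : Semiring c ℓ) where

  open import Data.Nat.Base using (zero; suc)

  open Semiring R
  open RangeSum +-commutativeMonoid public

  *-distribˡ-Σ : ∀ c f n → c * Σ f n ≈ ∑[ k < n ] (c * f k)
  *-distribˡ-Σ c f zero = zeroʳ c
  *-distribˡ-Σ c f (suc n) = trans (distribˡ c (Σ f n) (f n)) (+-congʳ (*-distribˡ-Σ c f n))

  *-distribʳ-Σ : ∀ c f n → Σ f n * c ≈ ∑[ k < n ] (f k * c)
  *-distribʳ-Σ c f zero = zeroˡ c
  *-distribʳ-Σ c f (suc n) = trans (distribʳ c (Σ f n) (f n)) (+-congʳ (*-distribʳ-Σ c f n))

module Binomial where

  open import Data.Nat.Base
  open import Data.Nat.Properties
  open import Data.Nat.Combinatorics using (_C_; nCk≡nC[n∸k]; nC1≡n; nCk+nC[k+1]≡[n+1]C[k+1]; k![n∸k]!∣n!)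
  open import Data.Nat.Combinatorics.Specification using (nCk≡n!/k![n-k]!; k>n⇒nCk≡0)
  open import Data.Nat.DivMod using (m/n*n≡m)
  open import Data.Nat.Divisibility using (_∣_; ∣1⇒≡1; ∣⇒≤; m∣m*n)
  open import Data.Nat.Primality using (Prime; euclidsLemma; ¬prime[1])
  open import Data.Nat.Solver using (module +-*-Solver)
  open import Data.Sum.Base using (inj₁; inj₂)
  open import Relation.Nullary.Decidable.Core using (yes; no)
  open import Relation.Nullary.Negation using (¬_; contradiction)
  open import Relation.Binary.PropositionalEquality

  open import Algebra.Properties.CommutativeSemigroup *-commutativeSemigroup using (x∙yz≈y∙xz)

  open SemiringRangeSum +-*-semiring public
  open +-*-Solver using (solve; _:*_; _:=_)
  open ≡-Reasoning

  C-factorial : ∀ {n k} → k ≤ n → (n C k) * (k ! * (n ∸ k) !) ≡ n !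
  C-factorial {n} {k} k≤n = begin
    (n C k) * (k ! * (n ∸ k) !) ≡⟨ cong (_* (k ! * (n ∸ k) !)) (nCk≡n!/k![n-k]! k≤n) ⟩
    (n ! / (k ! * (n ∸ k) !)) * (k ! * (n ∸ k) !) ≡⟨ m/n*n≡m (k![n∸k]!∣n! k≤n) ⟩
    n ! ∎
    where instance _ = k !* (n ∸ k) !≢0

  [1+n]Cn≡1+n : ∀ n → (suc n C n) ≡ suc n
  [1+n]Cn≡1+n n = begin
    (suc n C n)           ≡⟨ nCk≡nC[n∸k] (n≤1+n n) ⟩
    (suc n C (suc n ∸ n)) ≡⟨ cong (suc n C_) (m+n∸n≡m 1 n) ⟩
    (suc n C 1)           ≡⟨ nC1≡n (suc n) ⟩
    suc n                 ∎

  private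
    C-subset-factorial : ∀ n k i → k + i ≤ n → (n C k) * ((n ∸ k) C i) * (k ! * i ! * (n ∸ (k + i)) !) ≡ n !
    C-subset-factorial n k i k+i≤n = begin
      (n C k) * ((n ∸ k) C i) * (k ! * i ! * (n ∸ (k + i)) !)
        ≡⟨ cong (λ m → (n C k) * ((n ∸ k) C i) * (k ! * i ! * m !)) (sym (∸-+-assoc n k i)) ⟩
      (n C k) * ((n ∸ k) C i) * (k ! * i ! * (n ∸ k ∸ i) !)
        ≡⟨ solve 5 (λ a b c d e → a :* b :* (c :* d :* e) := a :* (c :* (b :* (d :* e))))
                 refl (n C k) ((n ∸ k) C i) (k !) (i !) ((n ∸ k ∸ i) !) ⟩
      (n C k) * (k ! * (((n ∸ k) C i) * (i ! * (n ∸ k ∸ i) !)))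
        ≡⟨ cong (λ m → (n C k) * (k ! * m)) (C-factorial (m+n≤o⇒m≤o∸n i (subst (_≤ n) (+-comm k i) k+i≤n))) ⟩
      (n C k) * (k ! * (n ∸ k) !)
        ≡⟨ C-factorial (m+n≤o⇒m≤o k k+i≤n) ⟩
      n ! ∎

    C-subset-vanishes : ∀ n k i → n < k + i → (n C k) * ((n ∸ k) C i) ≡ 0
    C-subset-vanishes n k i n<k+i with k ≤? n
    ... | no k≰n = cong (_* ((n ∸ k) C i)) (k>n⇒nCk≡0 (≰⇒> k≰n))
    ... | yes k≤n = trans (cong ((n C k) *_) (k>n⇒nCk≡0 n∸k<i)) (*-zeroʳ (n C k))
      where
      n∸k<i : n ∸ k < i
      n∸k<i = subst (n ∸ k <_) (m+n∸m≡n k i) (∸-monoˡ-< n<k+i k≤n)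

  C-subset-of-subset : ∀ n k i → (n C k) * ((n ∸ k) C i) ≡ (n C i) * ((n ∸ i) C k)
  C-subset-of-subset n k i with k + i ≤? n
  ... | yes k+i≤n = *-cancelʳ-≡ _ _ (k ! * i ! * (n ∸ (k + i)) !) {{factorials≢0}} (begin
    (n C k) * ((n ∸ k) C i) * (k ! * i ! * (n ∸ (k + i)) !) ≡⟨ C-subset-factorial n k i k+i≤n ⟩
    n !                                                 ≡⟨ C-subset-factorial n i k i+k≤n ⟨
    (n C i) * ((n ∸ i) C k) * (i ! * k ! * (n ∸ (i + k)) !) ≡⟨ cong₂ (λ a b → (n C i) * ((n ∸ i) C k) * (a * b !))
                                                            (*-comm (i !) (k !)) (cong (n ∸_) (+-comm i k)) ⟩
    (n C i) * ((n ∸ i) C k) * (k ! * i ! * (n ∸ (k + i)) !) ∎)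
    where
    i+k≤n = subst (_≤ n) (+-comm k i) k+i≤n
    factorials≢0 = m*n≢0 (k ! * i !) ((n ∸ (k + i)) !) {{m*n≢0 (k !) (i !) {{k !≢0}} {{i !≢0}}}} {{(n ∸ (k + i)) !≢0}}
  ... | no k+i≰n = trans (C-subset-vanishes n k i (≰⇒> k+i≰n))
                         (sym (C-subset-vanishes n i k (subst (n <_) (+-comm k i) (≰⇒> k+i≰n))))

  C-absorption : ∀ n k → (suc n C k) * (suc n ∸ k) ≡ suc n * (n C k)
  C-absorption n k = begin
    (suc n C k) * (suc n ∸ k)         ≡⟨ cong ((suc n C k) *_) (nC1≡n (suc n ∸ k)) ⟨
    (suc n C k) * ((suc n ∸ k) C 1)   ≡⟨ C-subset-of-subset (suc n) k 1 ⟩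
    (suc n C 1) * (n C k)             ≡⟨ cong (_* (n C k)) (nC1≡n (suc n)) ⟩
    suc n * (n C k)                   ∎

  binomial-theorem : ∀ x e → (x + 1) ^ e ≡ ∑[ i < suc e ] ((e C i) * x ^ i)
  binomial-theorem x zero = refl
  binomial-theorem x (suc e) = begin
    (x + 1) * (x + 1) ^ e
      ≡⟨ cong ((x + 1) *_) (binomial-theorem x e) ⟩
    (x + 1) * S
      ≡⟨ *-distribʳ-+ S x 1 ⟩
    x * S + 1 * S
      ≡⟨ cong₂ _+_ (*-distribˡ-Σ x _ (suc e)) (trans (*-identityˡ S) S-head) ⟩
    ∑[ i < suc e ] (x * ((e C i) * x ^ i)) + (1 + T)
      ≡⟨ +-suc _ T ⟩
    1 + (∑[ i < suc e ] (x * ((e C i) * x ^ i)) + T)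
      ≡⟨ cong (1 +_) (Σ-distrib _ _ (suc e)) ⟨
    1 + ∑[ i < suc e ] (x * ((e C i) * x ^ i) + (e C suc i) * x ^ suc i)
      ≡⟨ cong (1 +_) (Σ-cong (suc e) (λ i _ → pascal i)) ⟩
    1 + ∑[ i < suc e ] ((suc e C suc i) * x ^ suc i)
      ≡⟨ Σ-head (λ i → (suc e C i) * x ^ i) (suc e) ⟨
    ∑[ i < suc (suc e) ] ((suc e C i) * x ^ i)                 ∎
    where
    S = ∑[ i < suc e ] ((e C i) * x ^ i)
    T = ∑[ i < suc e ] ((e C suc i) * x ^ suc i)
    S-head : S ≡ 1 + T
    S-head = begin
      S                                      ≡⟨ Σ-extend (λ i → (e C i) * x ^ i) (n≤1+n (suc e)) vanish ⟨
      ∑[ i < suc (suc e) ] ((e C i) * x ^ i) ≡⟨ Σ-head (λ i → (e C i) * x ^ i) (suc e) ⟩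
      1 * 1 + T                              ∎
      where
      vanish : ∀ i → suc e ≤ i → (e C i) * x ^ i ≡ 0
      vanish i e<i = cong (_* x ^ i) (k>n⇒nCk≡0 e<i)
    pascal : ∀ i → x * ((e C i) * x ^ i) + (e C suc i) * x ^ suc i ≡ (suc e C suc i) * x ^ suc i
    pascal i = begin
      x * ((e C i) * x ^ i) + (e C suc i) * x ^ suc i  ≡⟨ cong (_+ (e C suc i) * x ^ suc i) (x∙yz≈y∙xz x (e C i) (x ^ i)) ⟩
      (e C i) * x ^ suc i + (e C suc i) * x ^ suc i    ≡⟨ *-distribʳ-+ (x ^ suc i) (e C i) (e C suc i) ⟨
      ((e C i) + (e C suc i)) * x ^ suc i              ≡⟨ cong (_* x ^ suc i) (nCk+nC[k+1]≡[n+1]C[k+1] e i) ⟩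
      (suc e C suc i) * x ^ suc i                      ∎

  prime∤factorial : ∀ {q} → Prime q → ∀ m → m < q → ¬ q ∣ m !
  prime∤factorial q-prime zero _ q∣1 = ¬prime[1] (subst Prime (∣1⇒≡1 q∣1) q-prime)
  prime∤factorial q-prime (suc m) m<q q∣m! with euclidsLemma (suc m) (m !) q-prime q∣m!
  ... | inj₁ q∣1+m = <⇒≱ m<q (∣⇒≤ q∣1+m)
  ... | inj₂ q∣m! = prime∤factorial q-prime m (<⇒≤ m<q) q∣m!

  prime∣C : ∀ {q} → Prime q → ∀ i → 0 < i → i < q → q ∣ q C i
  prime∣C {q@(suc q-1)} q-prime i 0<i i<q
    with euclidsLemma (q C i) (i ! * (q ∸ i) !) q-prime (subst (q ∣_) (sym (C-factorial (<⇒≤ i<q))) (m∣m*n (q-1 !)))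
  ... | inj₁ q∣C = q∣C
  ... | inj₂ q∣factorials with euclidsLemma (i !) ((q ∸ i) !) q-prime q∣factorials
  ...   | inj₁ q∣i! = contradiction q∣i! (prime∤factorial q-prime i i<q)
  ...   | inj₂ q∣[q-i]! = contradiction q∣[q-i]! (prime∤factorial q-prime (q ∸ i) (∸-monoʳ-< 0<i (<⇒≤ i<q)))

module PowerSum where

  open import Data.Nat.Base
  open import Data.Nat.Properties
  open import Data.Nat.Combinatorics using (_C_; nCn≡1)
  open import Data.Nat.DivMod using (_%_; _/_; %-distribˡ-+; %-distribˡ-*; m*n%n≡0; m≡m%n+[m/n]*n; m%n<n)
  open import Data.Nat.Divisibility
  open import Data.Nat.Induction using (<-rec)
  open import Data.Nat.Primality using (Prime; euclidsLemma; ¬prime[1])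
  open import Data.Sum.Base using (inj₁; inj₂)
  open import Function.Base using (_∘_)
  open import Relation.Nullary.Negation using (¬_; contradiction)
  open import Relation.Binary.PropositionalEquality
  open Binomial

  open ≡-Reasoning

  powerSum : ℕ → ℕ → ℕ
  powerSum n m = ∑[ j < m ] (j ^ n)

  powerSum-zero : ∀ m → powerSum 0 m ≡ m
  powerSum-zero zero = refl
  powerSum-zero (suc m) = trans (cong (_+ 1) (powerSum-zero m)) (+-comm m 1)

  -- Sum the expansion  (j + 1) ^ (m + 1) - j ^ (m + 1) = Σ_{i ≤ m} C(m+1,i) j ^ i  over j < Q.
  powerSum-telescope : ∀ m Q → ∑[ i < suc m ] ((suc m C i) * powerSum i Q) ≡ Q ^ suc m
  powerSum-telescope m zero = Σ-zero (suc m) (λ i _ → *-zeroʳ (suc m C i))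
  powerSum-telescope m (suc Q) = begin
    ∑[ i < suc m ] ((suc m C i) * (powerSum i Q + Q ^ i))
      ≡⟨ Σ-cong (suc m) (λ i _ → *-distribˡ-+ (suc m C i) (powerSum i Q) (Q ^ i)) ⟩
    ∑[ i < suc m ] ((suc m C i) * powerSum i Q + (suc m C i) * Q ^ i)
      ≡⟨ Σ-distrib _ _ (suc m) ⟩
    ∑[ i < suc m ] ((suc m C i) * powerSum i Q) + ∑[ i < suc m ] ((suc m C i) * Q ^ i)
      ≡⟨ cong (_+ ∑[ i < suc m ] ((suc m C i) * Q ^ i)) (powerSum-telescope m Q) ⟩
    Q ^ suc m + ∑[ i < suc m ] ((suc m C i) * Q ^ i)
      ≡⟨ +-comm (Q ^ suc m) _ ⟩
    ∑[ i < suc m ] ((suc m C i) * Q ^ i) + Q ^ suc m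
      ≡⟨ cong (∑[ i < suc m ] ((suc m C i) * Q ^ i) +_) (trans (cong (_* Q ^ suc m) (nCn≡1 (suc m))) (*-identityˡ _)) ⟨
    ∑[ i < suc (suc m) ] ((suc m C i) * Q ^ i)
      ≡⟨ binomial-theorem Q (suc m) ⟨
    (Q + 1) ^ suc m
      ≡⟨ cong (_^ suc m) (+-comm Q 1) ⟩
    suc Q ^ suc m ∎

  module Congruence (q : ℕ) .{{_ : NonZero q}} where

    infix 4 _≋_
    record _≋_ (a b : ℕ) : Set where
      constructor mk≋
      field %-≡ : a % q ≡ b % q

    ≋-reflexive : ∀ {a b} → a ≡ b → a ≋ b
    ≋-reflexive a≡b = mk≋ (cong (_% q) a≡b)

    ≋-refl : ∀ {a} → a ≋ a
    ≋-refl = ≋-reflexive refl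

    ≋-trans : ∀ {a b c} → a ≋ b → b ≋ c → a ≋ c
    ≋-trans (mk≋ a≋b) (mk≋ b≋c) = mk≋ (trans a≋b b≋c)

    +-cong≋ : ∀ {a b c d} → a ≋ b → c ≋ d → a + c ≋ b + d
    +-cong≋ {a} {b} {c} {d} (mk≋ a≋b) (mk≋ c≋d) = mk≋ (begin
      (a + c) % q             ≡⟨ %-distribˡ-+ a c q ⟩
      (a % q + c % q) % q     ≡⟨ cong₂ (λ x y → (x + y) % q) a≋b c≋d ⟩
      (b % q + d % q) % q     ≡⟨ %-distribˡ-+ b d q ⟨
      (b + d) % q             ∎)

    *-cong≋ : ∀ {a b c d} → a ≋ b → c ≋ d → a * c ≋ b * d
    *-cong≋ {a} {b} {c} {d} (mk≋ a≋b) (mk≋ c≋d) = mk≋ (begin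
      (a * c) % q             ≡⟨ %-distribˡ-* a c q ⟩
      (a % q * (c % q)) % q   ≡⟨ cong₂ (λ x y → (x * y) % q) a≋b c≋d ⟩
      (b % q * (d % q)) % q   ≡⟨ %-distribˡ-* b d q ⟨
      (b * d) % q             ∎)

    ^-cong≋ : ∀ {a b} e → a ≋ b → a ^ e ≋ b ^ e
    ^-cong≋ zero a≋b = ≋-refl
    ^-cong≋ (suc e) a≋b = *-cong≋ a≋b (^-cong≋ e a≋b)

    Σ-cong≋ : ∀ {f g} n → (∀ k → k < n → f k ≋ g k) → Σ f n ≋ Σ g n
    Σ-cong≋ = Σ-preserves {R = _≋_} ≋-refl +-cong≋

    ∣⇒≋0 : ∀ {a} → q ∣ a → a ≋ 0
    ∣⇒≋0 {a} q∣a = mk≋ (trans (n∣m⇒m%n≡0 a q q∣a) (sym (m*n%n≡0 0 q)))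

    ≋0⇒∣ : ∀ {a} → a ≋ 0 → q ∣ a
    ≋0⇒∣ {a} (mk≋ a≋0) = m%n≡0⇒n∣m a q (trans a≋0 (m*n%n≡0 0 q))

    +-cancelʳ≋ : ∀ a b → a + b ≋ b → q ∣ a
    +-cancelʳ≋ a b (mk≋ a+b≋b) = ∣m+n∣m⇒∣n q∣[b/q]q+a (n∣m*n (b / q))
      where
      q∣[b/q]q+a : q ∣ (b / q) * q + a
      q∣[b/q]q+a = divides ((a + b) / q) (+-cancelʳ-≡ (b % q) _ _ (begin
        (b / q) * q + a + b % q   ≡⟨ +-assoc ((b / q) * q) a (b % q) ⟩
        (b / q) * q + (a + b % q) ≡⟨ cong ((b / q) * q +_) (+-comm a (b % q)) ⟩
        (b / q) * q + (b % q + a) ≡⟨ +-assoc ((b / q) * q) (b % q) a ⟨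
        (b / q) * q + b % q + a   ≡⟨ cong (_+ a) (trans (m≡m%n+[m/n]*n b q) (+-comm (b % q) _)) ⟨
        b + a                     ≡⟨ +-comm b a ⟩
        a + b                     ≡⟨ m≡m%n+[m/n]*n (a + b) q ⟩
        (a + b) % q + ((a + b) / q) * q ≡⟨ cong (_+ ((a + b) / q) * q) a+b≋b ⟩
        b % q + ((a + b) / q) * q ≡⟨ +-comm (b % q) _ ⟩
        ((a + b) / q) * q + b % q ∎))

  module _ {q-1 : ℕ} (q-prime : Prime (suc q-1)) where

    private
      q = suc q-1
      instance
        q-1≢0 : NonZero q-1
        q-1≢0 = ≢-nonZero {q-1} λ { refl → ¬prime[1] q-prime }

    open Congruence q

    fermat : ∀ j → j ^ q ≋ j
    fermat zero = ≋-refl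
    fermat (suc j) = ≋-trans (≋-reflexive expand) (+-cong≋ {1} ≋-refl (≋-trans (+-cong≋ middle ≋-refl) (fermat j)))
      where
      middle : ∑[ i < q-1 ] ((q C suc i) * j ^ suc i) ≋ 0
      middle = ∣⇒≋0 (Σ-closed {P = q ∣_} (q ∣0) ∣m∣n⇒∣m+n q-1
                       (λ i i<q-1 → ∣m⇒∣m*n (j ^ suc i) (prime∣C q-prime (suc i) z<s (s<s i<q-1))))
      expand : suc j ^ q ≡ 1 + (∑[ i < q-1 ] ((q C suc i) * j ^ suc i) + j ^ q)
      expand = begin
        suc j ^ q
          ≡⟨ cong (_^ q) (+-comm 1 j) ⟩
        (j + 1) ^ q
          ≡⟨ binomial-theorem j q ⟩
        ∑[ i < suc q ] ((q C i) * j ^ i)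
          ≡⟨ Σ-head (λ i → (q C i) * j ^ i) q ⟩
        1 * 1 + (∑[ i < q-1 ] ((q C suc i) * j ^ suc i) + (q C q) * j ^ q)
          ≡⟨ cong (λ c → 1 + (∑[ i < q-1 ] ((q C suc i) * j ^ suc i) + c * j ^ q)) (nCn≡1 q) ⟩
        1 + (∑[ i < q-1 ] ((q C suc i) * j ^ suc i) + 1 * j ^ q)
          ≡⟨ cong (λ x → 1 + (∑[ i < q-1 ] ((q C suc i) * j ^ suc i) + x)) (*-identityˡ (j ^ q)) ⟩
        1 + (∑[ i < q-1 ] ((q C suc i) * j ^ suc i) + j ^ q)               ∎

    fermat-unit : ∀ j → 0 < j → j < q → j ^ q-1 ≋ 1
    fermat-unit j 0<j j<q with j ^ q-1 in j^[q-1]≡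
    ... | zero = contradiction j^[q-1]≡ (≢-nonZero⁻¹ _ {{m^n≢0 j q-1 {{>-nonZero 0<j}}}})
    ... | suc x = ≋-trans (≋-reflexive (+-comm 1 x)) (+-cong≋ (∣⇒≋0 q∣x) ≋-refl)
      where
      jx+j≋j : j * x + j ≋ j
      jx+j≋j = ≋-trans (≋-reflexive (trans (+-comm (j * x) j) (trans (sym (*-suc j x)) (cong (j *_) (sym j^[q-1]≡)))))
                       (fermat j)
      q∣x : q ∣ x
      q∣x with euclidsLemma j x q-prime (+-cancelʳ≋ (j * x) j jx+j≋j)
      ... | inj₁ q∣j = contradiction (∣⇒≤ {{>-nonZero 0<j}} q∣j) (<⇒≱ j<q)
      ... | inj₂ q∣x = q∣x

    prime∣powerSum-small : ∀ i → 0 < i → suc i < q → q ∣ powerSum i q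
    prime∣powerSum-small = <-rec _ step
      where
      step : ∀ i → (∀ {k} → k < i → 0 < k → suc k < q → q ∣ powerSum k q) → 0 < i → suc i < q → q ∣ powerSum i q
      step i rec 0<i 1+i<q with euclidsLemma (suc i) (powerSum i q) q-prime q∣[1+i]S
        where
        q∣lower : q ∣ ∑[ k < i ] ((suc i C k) * powerSum k q)
        q∣lower = Σ-closed {P = q ∣_} (q ∣0) ∣m∣n⇒∣m+n i λ
          { zero _ → ∣n⇒∣m*n (suc i C 0) (subst (q ∣_) (sym (powerSum-zero q)) ∣-refl)
          ; (suc k) k<i → ∣n⇒∣m*n (suc i C suc k) (rec k<i z<s (<-trans (s<s k<i) 1+i<q)) }
        q∣[1+i]S : q ∣ suc i * powerSum i q
        q∣[1+i]S = subst (λ c → q ∣ c * powerSum i q) ([1+n]Cn≡1+n i)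
          (∣m+n∣m⇒∣n (subst (q ∣_) (sym (powerSum-telescope i q)) (∣m⇒∣m*n (q ^ i) ∣-refl)) q∣lower)
      ... | inj₁ q∣1+i = contradiction (∣⇒≤ q∣1+i) (<⇒≱ 1+i<q)
      ... | inj₂ q∣S = q∣S

    private
      power-reduce : ∀ n j → 0 < j → j < q → j ^ n ≋ j ^ (n % q-1)
      power-reduce n j 0<j j<q =
        ≋-trans (≋-reflexive split)
                (≋-trans (*-cong≋ (≋-refl {j ^ r}) (^-cong≋ (n / q-1) (fermat-unit j 0<j j<q)))
                         (≋-reflexive (trans (cong (j ^ r *_) (^-zeroˡ (n / q-1))) (*-identityʳ (j ^ r)))))
        where
        r = n % q-1
        split : j ^ n ≡ j ^ r * (j ^ q-1) ^ (n / q-1)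
        split = begin
          j ^ n                             ≡⟨ cong (j ^_) (m≡m%n+[m/n]*n n q-1) ⟩
          j ^ (r + (n / q-1) * q-1)         ≡⟨ ^-distribˡ-+-* j r _ ⟩
          j ^ r * j ^ ((n / q-1) * q-1)     ≡⟨ cong (λ e → j ^ r * j ^ e) (*-comm (n / q-1) q-1) ⟩
          j ^ r * j ^ (q-1 * (n / q-1))     ≡⟨ cong (j ^ r *_) (^-*-assoc j q-1 (n / q-1)) ⟨
          j ^ r * (j ^ q-1) ^ (n / q-1)     ∎

    powerSum-multiple : ∀ n → 0 < n → q-1 ∣ n → q ∣ powerSum n q + 1
    powerSum-multiple n@(suc _) 0<n q-1∣n = ≋0⇒∣ (≋-trans (+-cong≋ {b = 0 + q-1} terms ≋-refl)
                                                        (≋-trans (≋-reflexive (+-comm q-1 1)) (∣⇒≋0 ∣-refl)))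
      where
      terms : powerSum n q ≋ 0 + q-1
      terms = ≋-trans (≋-reflexive (Σ-head (λ j → j ^ n) q-1))
                (+-cong≋ ≋-refl (≋-trans (Σ-cong≋ q-1 (λ j j<q-1 →
                  ≋-trans (power-reduce n (suc j) z<s (s<s j<q-1)) (≋-reflexive (cong (suc j ^_) (n∣m⇒m%n≡0 n q-1 q-1∣n)))))
                  (≋-reflexive (powerSum-zero q-1))))

    powerSum-nonmultiple : ∀ n → 0 < n → ¬ q-1 ∣ n → q ∣ powerSum n q
    powerSum-nonmultiple n 0<n q-1∤n = ≋0⇒∣ (≋-trans (Σ-cong≋ q reduce) (∣⇒≋0 (prime∣powerSum-small r 0<r (s<s (m%n<n n q-1)))))
      where
      r = n % q-1
      0<r : 0 < r
      0<r = n≢0⇒n>0 (q-1∤n ∘ m%n≡0⇒n∣m n q-1)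
      reduce : ∀ j → j < q → j ^ n ≋ j ^ r
      reduce zero _ = ≋-reflexive (trans (0^n≡0 n 0<n) (sym (0^n≡0 r 0<r)))
        where
        0^n≡0 : ∀ n → 0 < n → 0 ^ n ≡ 0
        0^n≡0 (suc n) _ = refl
      reduce (suc j) j<q = power-reduce n (suc j) z<s j<q

module RationalArithmetic where

  open import Data.Integer.Base as ℤ using (ℤ; +_; -[1+_])
  import Data.Integer.Properties as ℤ
  open import Data.Nat.Base as ℕ using (ℕ; zero; suc)
  open import Data.Nat.Coprimality as Coprimality using (Coprime; 1-coprimeTo)
  import Data.Nat.Properties as ℕ
  open import Data.Rational.Base
  open import Data.Rational.Properties
  open import Function.Base using (_∘_)
  open import Relation.Binary.PropositionalEquality

  open SemiringRangeSum (Ring.semiring +-*-ring) public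
  private module ℕΣ = SemiringRangeSum ℕ.+-*-semiring
  open ≡-Reasoning

  fromℤ : ℤ → ℚ
  fromℤ a = a / 1

  fromℕ : ℕ → ℚ
  fromℕ n = + n / 1

  private
    coprime-1 : ∀ n → Coprime n 1
    coprime-1 n = Coprimality.sym (1-coprimeTo n)

  fromℤ-mkℚ : ∀ a → fromℤ a ≡ mkℚ a 0 (coprime-1 ℤ.∣ a ∣)
  fromℤ-mkℚ (+ n) = normalize-coprime (coprime-1 n)
  fromℤ-mkℚ -[1+ n ] = cong -_ (normalize-coprime (coprime-1 (suc n)))

  fromℤ-+ : ∀ a b → fromℤ (a ℤ.+ b) ≡ fromℤ a + fromℤ b
  fromℤ-+ a b = begin
    fromℤ (a ℤ.+ b)                                     ≡⟨ cong fromℤ (cong₂ ℤ._+_ (ℤ.*-identityʳ a) (ℤ.*-identityʳ b)) ⟨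
    fromℤ (a ℤ.* + 1 ℤ.+ b ℤ.* + 1)                     ≡⟨⟩
    mkℚ a 0 (coprime-1 _) + mkℚ b 0 (coprime-1 _)       ≡⟨ cong₂ _+_ (fromℤ-mkℚ a) (fromℤ-mkℚ b) ⟨
    fromℤ a + fromℤ b                                   ∎

  fromℤ-* : ∀ a b → fromℤ (a ℤ.* b) ≡ fromℤ a * fromℤ b
  fromℤ-* a b = sym (cong₂ _*_ (fromℤ-mkℚ a) (fromℤ-mkℚ b))

  fromℤ-neg : ∀ a → fromℤ (ℤ.- a) ≡ - fromℤ a
  fromℤ-neg a = trans (fromℤ-mkℚ (ℤ.- a)) (trans (neg-mkℚ a) (cong -_ (sym (fromℤ-mkℚ a))))
    where
    neg-mkℚ : ∀ a → mkℚ (ℤ.- a) 0 (coprime-1 _) ≡ - mkℚ a 0 (coprime-1 _)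
    neg-mkℚ (+ zero) = refl
    neg-mkℚ (+ suc n) = refl
    neg-mkℚ -[1+ n ] = refl

  fromℤ-injective : ∀ {a b} → fromℤ a ≡ fromℤ b → a ≡ b
  fromℤ-injective {a} {b} eq = trans (cong ↥_ (sym (fromℤ-mkℚ a))) (trans (cong ↥_ eq) (cong ↥_ (fromℤ-mkℚ b)))

  fromℕ-+ : ∀ m n → fromℕ (m ℕ.+ n) ≡ fromℕ m + fromℕ n
  fromℕ-+ m n = fromℤ-+ (+ m) (+ n)

  fromℕ-* : ∀ m n → fromℕ (m ℕ.* n) ≡ fromℕ m * fromℕ n
  fromℕ-* m n = trans (cong fromℤ (ℤ.pos-* m n)) (fromℤ-* (+ m) (+ n))

  fromℕ-Σ : ∀ f n → fromℕ (ℕΣ.Σ f n) ≡ Σ (fromℕ ∘ f) n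
  fromℕ-Σ f zero = refl
  fromℕ-Σ f (suc n) = trans (fromℕ-+ (ℕΣ.Σ f n) (f n)) (cong (_+ fromℕ (f n)) (fromℕ-Σ f n))

  1/suc : ℕ → ℚ
  1/suc k = + 1 / suc k

  fromℕ-*-1/suc : ∀ k → fromℕ (suc k) * 1/suc k ≡ 1ℚ
  fromℕ-*-1/suc k = begin
    fromℕ (suc k) * 1/suc k
      ≡⟨ cong₂ _*_ (fromℤ-mkℚ (+ suc k)) (normalize-coprime (1-coprimeTo (suc k))) ⟩
    mkℚ (+ suc k) 0 (coprime-1 (suc k)) * mkℚ (+ 1) k (1-coprimeTo (suc k))
      ≡⟨ *-inverseʳ (mkℚ (+ suc k) 0 (coprime-1 (suc k))) ⟩
    1ℚ                                                               ∎

  *-cancelˡ-fromℕ : ∀ m .{{_ : ℕ.NonZero m}} {a b} → fromℕ m * a ≡ fromℕ m * b → a ≡ b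
  *-cancelˡ-fromℕ (suc n) {a} {b} eq = begin
    a                                  ≡⟨ scale a ⟨
    1/suc n * (fromℕ (suc n) * a)      ≡⟨ cong (1/suc n *_) eq ⟩
    1/suc n * (fromℕ (suc n) * b)      ≡⟨ scale b ⟩
    b                                  ∎
    where
    scale : ∀ x → 1/suc n * (fromℕ (suc n) * x) ≡ x
    scale x = begin
      1/suc n * (fromℕ (suc n) * x)    ≡⟨ *-assoc (1/suc n) (fromℕ (suc n)) x ⟨
      1/suc n * fromℕ (suc n) * x      ≡⟨ cong (_* x) (trans (*-comm (1/suc n) (fromℕ (suc n))) (fromℕ-*-1/suc n)) ⟩
      1ℚ * x                           ≡⟨ *-identityˡ x ⟩
      x                                ∎

module BernoulliRecurrence where

  open import Data.List.Base using (List; []; _∷_; [_]; _++_; length)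
  open import Data.List.Properties using (length-++)
  open import Data.Nat.Base as ℕ using (ℕ; zero; suc)
  import Data.Nat.Properties as ℕ
  open import Data.Nat.Combinatorics using (_C_)
  open import Data.Rational.Base using (ℚ; 0ℚ; 1ℚ; -_; _+_; _*_)
  open import Data.Rational.Properties using (+-assoc; +-identityˡ; +-identityʳ)
  open import Data.Rational.Solver using (module +-*-Solver)
  open import Relation.Binary.PropositionalEquality hiding ([_])
  open import Defs using (bernoullis; B)
  open RationalArithmetic
  open Binomial using ([1+n]Cn≡1+n)

  open +-*-Solver using (solve; _:+_; _:*_; :-_; _:=_; con)
  open ≡-Reasoning

  private
    Wsum : ℕ → ℕ → List ℚ → ℚ
    Wsum N i [] = 0ℚ
    Wsum N i (x ∷ xs) = fromℕ (N C i) * x + Wsum N (suc i) xs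

    -- Defs keeps the weighted sum in the recursion of `bernoullis`, and the last-element function
    -- behind `B`, private.  The metavariables below are solved by unification against the
    -- definitional unfoldings of `bernoullis` and `B` (the `with`s turn these into pattern problems),
    -- which makes the defining equations of those private functions available here.
    mutual
      X : ℕ → ℚ
      X = _

      wsum : ℕ → ℕ → List ℚ → ℚ
      wsum = _

      last : List ℚ → ℚ
      last = _

      bernoullis-unfold : ∀ n → bernoullis (suc n) ≡ bernoullis n ++ [ - (1/suc (suc n) * X n) ]
      bernoullis-unfold n = refl

      X≡Wsum : ∀ n → X n ≡ Wsum (suc (suc n)) 0 (bernoullis n)
      X≡Wsum n with suc (suc n) | 0 | bernoullis n
      ... | N | i | xs = wsum≡Wsum N i xs

      wsum≡Wsum : ∀ N i xs → wsum N i xs ≡ Wsum N i xs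
      wsum≡Wsum N i [] = refl
      wsum≡Wsum N i (x ∷ xs) = cong (fromℕ (N C i) * x +_) (wsum≡Wsum N (suc i) xs)

      B≡last : ∀ n → B n ≡ last (bernoullis n)
      B≡last n with bernoullis n
      ... | xs = refl

      last-snoc : ∀ xs w → last (xs ++ [ w ]) ≡ w
      last-snoc [] w = refl
      last-snoc (x ∷ []) w = refl
      last-snoc (x ∷ y ∷ xs) w = last-snoc (y ∷ xs) w

    B-suc : ∀ n → B (suc n) ≡ - (1/suc (suc n) * X n)
    B-suc n = trans (B≡last (suc n)) (last-snoc (bernoullis n) _)

    bernoullis-snoc : ∀ n → bernoullis (suc n) ≡ bernoullis n ++ [ B (suc n) ]
    bernoullis-snoc n = trans (bernoullis-unfold n) (cong (λ b → bernoullis n ++ [ b ]) (sym (B-suc n)))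

    length-bernoullis : ∀ n → length (bernoullis n) ≡ suc n
    length-bernoullis zero = refl
    length-bernoullis (suc n) = begin
      length (bernoullis (suc n))                   ≡⟨ cong length (bernoullis-snoc n) ⟩
      length (bernoullis n ++ [ B (suc n) ])        ≡⟨ length-++ (bernoullis n) ⟩
      length (bernoullis n) ℕ.+ 1                   ≡⟨ cong (ℕ._+ 1) (length-bernoullis n) ⟩
      suc n ℕ.+ 1                                   ≡⟨ ℕ.+-comm (suc n) 1 ⟩
      suc (suc n)                                   ∎

    Wsum-++ : ∀ N i xs ys → Wsum N i (xs ++ ys) ≡ Wsum N i xs + Wsum N (i ℕ.+ length xs) ys
    Wsum-++ N i [] ys = trans (cong (λ j → Wsum N j ys) (sym (ℕ.+-identityʳ i))) (sym (+-identityˡ _))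
    Wsum-++ N i (x ∷ xs) ys = begin
      fromℕ (N C i) * x + Wsum N (suc i) (xs ++ ys)
        ≡⟨ cong (fromℕ (N C i) * x +_) (Wsum-++ N (suc i) xs ys) ⟩
      fromℕ (N C i) * x + (Wsum N (suc i) xs + Wsum N (suc i ℕ.+ length xs) ys)
        ≡⟨ +-assoc (fromℕ (N C i) * x) (Wsum N (suc i) xs) _ ⟨
      fromℕ (N C i) * x + Wsum N (suc i) xs + Wsum N (suc i ℕ.+ length xs) ys
        ≡⟨ cong (λ j → fromℕ (N C i) * x + Wsum N (suc i) xs + Wsum N j ys) (ℕ.+-suc i (length xs)) ⟨
      fromℕ (N C i) * x + Wsum N (suc i) xs + Wsum N (i ℕ.+ suc (length xs)) ys ∎

    Wsum-bernoullis : ∀ N n → Wsum N 0 (bernoullis n) ≡ ∑[ k < suc n ] (fromℕ (N C k) * B k)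
    Wsum-bernoullis N zero = trans (+-identityʳ (fromℕ (N C 0) * B 0)) (sym (+-identityˡ (fromℕ (N C 0) * B 0)))
    Wsum-bernoullis N (suc n) = begin
      Wsum N 0 (bernoullis (suc n))                                      ≡⟨ cong (Wsum N 0) (bernoullis-snoc n) ⟩
      Wsum N 0 (bernoullis n ++ [ B (suc n) ])                           ≡⟨ Wsum-++ N 0 (bernoullis n) _ ⟩
      Wsum N 0 (bernoullis n) + Wsum N (length (bernoullis n)) [ B (suc n) ]
        ≡⟨ cong₂ (λ s j → s + Wsum N j [ B (suc n) ]) (Wsum-bernoullis N n) (length-bernoullis n) ⟩
      ∑[ k < suc n ] (fromℕ (N C k) * B k) + (fromℕ (N C suc n) * B (suc n) + 0ℚ)
        ≡⟨ cong (∑[ k < suc n ] (fromℕ (N C k) * B k) +_) (+-identityʳ _) ⟩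
      ∑[ k < suc (suc n) ] (fromℕ (N C k) * B k)                         ∎

  bernoulli-recurrence : ∀ n → ∑[ k < suc (suc n) ] (fromℕ (suc (suc n) C k) * B k) ≡ 0ℚ
  bernoulli-recurrence n = begin
    S + fromℕ (suc (suc n) C suc n) * B (suc n)
      ≡⟨ cong₂ (λ c b → S + fromℕ c * b) ([1+n]Cn≡1+n (suc n)) (B-suc n) ⟩
    S + fromℕ (suc (suc n)) * - (1/suc (suc n) * X n)
      ≡⟨ cong (λ x → S + fromℕ (suc (suc n)) * - (1/suc (suc n) * x)) (trans (X≡Wsum n) (Wsum-bernoullis (suc (suc n)) n)) ⟩
    S + fromℕ (suc (suc n)) * - (1/suc (suc n) * S)
      ≡⟨ solve 3 (λ s a i → s :+ a :* (:- (i :* s)) := s :+ (:- ((a :* i) :* s))) refl S (fromℕ (suc (suc n))) (1/suc (suc n)) ⟩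
    S + - (fromℕ (suc (suc n)) * 1/suc (suc n) * S)
      ≡⟨ cong (λ c → S + - (c * S)) (fromℕ-*-1/suc (suc n)) ⟩
    S + - (1ℚ * S)
      ≡⟨ solve 1 (λ s → s :+ (:- (con 1ℚ :* s)) := con 0ℚ) refl S ⟩
    0ℚ                                              ∎
    where
    S = ∑[ k < suc n ] (fromℕ (suc (suc n) C k) * B k)

module Faulhaber where

  open import Data.Nat.Base as ℕ using (ℕ; zero; suc; _∸_; _^_; _≤_; _<_; s≤s)
  import Data.Nat.Properties as ℕ
  open import Data.Nat.Combinatorics using (_C_; nCn≡1; nCk≡nC[n∸k])
  open import Data.Nat.Combinatorics.Specification using (k>n⇒nCk≡0)
  open import Data.Rational.Base using (ℚ; 0ℚ; 1ℚ; _+_; _*_)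
  open import Data.Rational.Properties
  open import Data.Rational.Solver using (module +-*-Solver)
  open import Relation.Binary.PropositionalEquality
  open import Defs using (B)
  open RationalArithmetic
  open BernoulliRecurrence
  open Binomial using (binomial-theorem; C-subset-of-subset; C-absorption; [1+n]Cn≡1+n)
  open PowerSum using (powerSum)
  open import Algebra.Properties.CommutativeSemigroup ℕ.*-commutativeSemigroup using (xy∙z≈xz∙y)

  open +-*-Solver using (solve; _:+_; _:*_; :-_; _:=_; con)
  open ≡-Reasoning

  δ₁ : ℕ → ℚ
  δ₁ zero = 0ℚ
  δ₁ (suc zero) = 1ℚ
  δ₁ (suc (suc _)) = 0ℚ

  binomial-sum-bernoulli : ∀ M → ∑[ k < suc M ] (fromℕ (M C k) * B k) ≡ B M + δ₁ M
  binomial-sum-bernoulli zero = refl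
  binomial-sum-bernoulli (suc zero) = refl
  binomial-sum-bernoulli (suc (suc m)) = begin
    ∑[ k < suc (suc m) ] (fromℕ (suc (suc m) C k) * B k) + fromℕ (suc (suc m) C suc (suc m)) * B (suc (suc m))
      ≡⟨ cong₂ (λ s c → s + fromℕ c * B (suc (suc m))) (bernoulli-recurrence m) (nCn≡1 (suc (suc m))) ⟩
    0ℚ + 1ℚ * B (suc (suc m))
      ≡⟨ solve 1 (λ b → con 0ℚ :+ con 1ℚ :* b := b :+ con 0ℚ) refl (B (suc (suc m))) ⟩
    B (suc (suc m)) + 0ℚ ∎

  bernoulliPoly : ℕ → ℕ → ℚ
  bernoulliPoly N x = ∑[ k < suc N ] (fromℕ ((N C k) ℕ.* x ^ (N ∸ k)) * B k)

  private

    expand-power : ∀ N x k → k ≤ N →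
                   fromℕ ((N C k) ℕ.* suc x ^ (N ∸ k)) ≡ ∑[ i < suc N ] fromℕ ((N C k) ℕ.* (((N ∸ k) C i) ℕ.* x ^ i))
    expand-power N x k k≤N = begin
      fromℕ ((N C k) ℕ.* suc x ^ (N ∸ k))
        ≡⟨ cong (λ y → fromℕ ((N C k) ℕ.* y ^ (N ∸ k))) (ℕ.+-comm 1 x) ⟩
      fromℕ ((N C k) ℕ.* (x ℕ.+ 1) ^ (N ∸ k))
        ≡⟨ cong (λ y → fromℕ ((N C k) ℕ.* y)) (binomial-theorem x (N ∸ k)) ⟩
      fromℕ ((N C k) ℕ.* Binomial.∑[ i < suc (N ∸ k) ] (((N ∸ k) C i) ℕ.* x ^ i))
        ≡⟨ cong fromℕ (Binomial.*-distribˡ-Σ (N C k) _ (suc (N ∸ k))) ⟩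
      fromℕ (Binomial.∑[ i < suc (N ∸ k) ] ((N C k) ℕ.* (((N ∸ k) C i) ℕ.* x ^ i)))
        ≡⟨ cong fromℕ (Binomial.Σ-extend _ (s≤s (ℕ.m∸n≤m N k)) vanish) ⟨
      fromℕ (Binomial.∑[ i < suc N ] ((N C k) ℕ.* (((N ∸ k) C i) ℕ.* x ^ i)))
        ≡⟨ fromℕ-Σ _ (suc N) ⟩
      ∑[ i < suc N ] fromℕ ((N C k) ℕ.* (((N ∸ k) C i) ℕ.* x ^ i)) ∎
      where
      vanish : ∀ i → suc (N ∸ k) ≤ i → (N C k) ℕ.* (((N ∸ k) C i) ℕ.* x ^ i) ≡ 0
      vanish i N-k<i = trans (cong (λ c → (N C k) ℕ.* (c ℕ.* x ^ i)) (k>n⇒nCk≡0 N-k<i)) (ℕ.*-zeroʳ (N C k))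

    regroup : ∀ N x k i → (N C k) ℕ.* (((N ∸ k) C i) ℕ.* x ^ i) ≡ (N C i) ℕ.* x ^ i ℕ.* ((N ∸ i) C k)
    regroup N x k i = begin
      (N C k) ℕ.* (((N ∸ k) C i) ℕ.* x ^ i) ≡⟨ ℕ.*-assoc (N C k) ((N ∸ k) C i) (x ^ i) ⟨
      (N C k) ℕ.* ((N ∸ k) C i) ℕ.* x ^ i   ≡⟨ cong (ℕ._* x ^ i) (C-subset-of-subset N k i) ⟩
      (N C i) ℕ.* ((N ∸ i) C k) ℕ.* x ^ i   ≡⟨ xy∙z≈xz∙y (N C i) ((N ∸ i) C k) (x ^ i) ⟩
      (N C i) ℕ.* x ^ i ℕ.* ((N ∸ i) C k)   ∎

    bernoulliPoly-reverse : ∀ N x → bernoulliPoly N x ≡ ∑[ i < suc N ] (fromℕ ((N C i) ℕ.* x ^ i) * B (N ∸ i))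
    bernoulliPoly-reverse N x = trans (Σ-reverse _ (suc N)) (Σ-cong (suc N) λ i i<1+N → begin
      fromℕ ((N C (N ∸ i)) ℕ.* x ^ (N ∸ (N ∸ i))) * B (N ∸ i)
        ≡⟨ cong₂ (λ c e → fromℕ (c ℕ.* x ^ e) * B (N ∸ i)) (sym (nCk≡nC[n∸k] (ℕ.s≤s⁻¹ i<1+N))) (ℕ.m∸[m∸n]≡n (ℕ.s≤s⁻¹ i<1+N)) ⟩
      fromℕ ((N C i) ℕ.* x ^ i) * B (N ∸ i) ∎)

    binomial-sum-bernoulli-extended : ∀ N i → i ≤ N → ∑[ k < suc N ] (fromℕ ((N ∸ i) C k) * B k) ≡ B (N ∸ i) + δ₁ (N ∸ i)
    binomial-sum-bernoulli-extended N i i≤N =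
      trans (Σ-extend _ (s≤s (ℕ.m∸n≤m N i)) vanish) (binomial-sum-bernoulli (N ∸ i))
      where
      vanish : ∀ k → suc (N ∸ i) ≤ k → fromℕ ((N ∸ i) C k) * B k ≡ 0ℚ
      vanish k N-i<k = trans (cong (λ c → fromℕ c * B k) (k>n⇒nCk≡0 N-i<k)) (*-zeroˡ (B k))

  bernoulliPoly-suc : ∀ N x → bernoulliPoly N (suc x) ≡
                      bernoulliPoly N x + ∑[ i < suc N ] (fromℕ ((N C i) ℕ.* x ^ i) * δ₁ (N ∸ i))
  bernoulliPoly-suc N x = begin
    ∑[ k < suc N ] (fromℕ ((N C k) ℕ.* suc x ^ (N ∸ k)) * B k)
      ≡⟨ Σ-cong (suc N) (λ k k<1+N → trans (cong (_* B k) (expand-power N x k (ℕ.s≤s⁻¹ k<1+N))) (*-distribʳ-Σ (B k) _ (suc N))) ⟩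
    ∑[ k < suc N ] ∑[ i < suc N ] (fromℕ ((N C k) ℕ.* (((N ∸ k) C i) ℕ.* x ^ i)) * B k)
      ≡⟨ Σ-comm _ (suc N) (suc N) ⟩
    ∑[ i < suc N ] ∑[ k < suc N ] (fromℕ ((N C k) ℕ.* (((N ∸ k) C i) ℕ.* x ^ i)) * B k)
      ≡⟨ Σ-cong (suc N) (λ i _ → Σ-cong (suc N) (λ k _ → regroupℚ i k)) ⟩
    ∑[ i < suc N ] ∑[ k < suc N ] (c i * (fromℕ ((N ∸ i) C k) * B k))
      ≡⟨ Σ-cong (suc N) (λ i _ → *-distribˡ-Σ (c i) _ (suc N)) ⟨
    ∑[ i < suc N ] (c i * ∑[ k < suc N ] (fromℕ ((N ∸ i) C k) * B k))
      ≡⟨ Σ-cong (suc N) (λ i i<1+N → cong (c i *_) (binomial-sum-bernoulli-extended N i (ℕ.s≤s⁻¹ i<1+N))) ⟩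
    ∑[ i < suc N ] (c i * (B (N ∸ i) + δ₁ (N ∸ i)))
      ≡⟨ Σ-cong (suc N) (λ i _ → *-distribˡ-+ (c i) (B (N ∸ i)) (δ₁ (N ∸ i))) ⟩
    ∑[ i < suc N ] (c i * B (N ∸ i) + c i * δ₁ (N ∸ i))
      ≡⟨ Σ-distrib _ _ (suc N) ⟩
    ∑[ i < suc N ] (c i * B (N ∸ i)) + ∑[ i < suc N ] (c i * δ₁ (N ∸ i))
      ≡⟨ cong (_+ ∑[ i < suc N ] (c i * δ₁ (N ∸ i))) (bernoulliPoly-reverse N x) ⟨
    bernoulliPoly N x + ∑[ i < suc N ] (c i * δ₁ (N ∸ i)) ∎
    where
    c : ℕ → ℚ
    c i = fromℕ ((N C i) ℕ.* x ^ i)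
    regroupℚ : ∀ i k → fromℕ ((N C k) ℕ.* (((N ∸ k) C i) ℕ.* x ^ i)) * B k ≡ c i * (fromℕ ((N ∸ i) C k) * B k)
    regroupℚ i k = begin
      fromℕ ((N C k) ℕ.* (((N ∸ k) C i) ℕ.* x ^ i)) * B k ≡⟨ cong (λ n → fromℕ n * B k) (regroup N x k i) ⟩
      fromℕ ((N C i) ℕ.* x ^ i ℕ.* ((N ∸ i) C k)) * B k   ≡⟨ cong (_* B k) (fromℕ-* ((N C i) ℕ.* x ^ i) ((N ∸ i) C k)) ⟩
      c i * fromℕ ((N ∸ i) C k) * B k                     ≡⟨ *-assoc (c i) _ (B k) ⟩
      c i * (fromℕ ((N ∸ i) C k) * B k)                   ∎

  private
    δ₁-sum : ∀ n x → ∑[ i < suc (suc n) ] (fromℕ ((suc n C i) ℕ.* x ^ i) * δ₁ (suc n ∸ i)) ≡ fromℕ (suc n ℕ.* x ^ n)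
    δ₁-sum n x = begin
      ∑[ i < n ] f i + f n + f (suc n)   ≡⟨ cong₂ (λ s t → s + f n + t) (Σ-zero n vanish) last-vanishes ⟩
      0ℚ + f n + 0ℚ                      ≡⟨ trans (+-identityʳ _) (+-identityˡ (f n)) ⟩
      f n                                ≡⟨ cong (λ e → fromℕ ((suc n C n) ℕ.* x ^ n) * δ₁ e) (ℕ.m+n∸n≡m 1 n) ⟩
      fromℕ ((suc n C n) ℕ.* x ^ n) * 1ℚ ≡⟨ *-identityʳ _ ⟩
      fromℕ ((suc n C n) ℕ.* x ^ n)      ≡⟨ cong (λ c → fromℕ (c ℕ.* x ^ n)) ([1+n]Cn≡1+n n) ⟩
      fromℕ (suc n ℕ.* x ^ n)            ∎
      where
      f : ℕ → ℚ
      f i = fromℕ ((suc n C i) ℕ.* x ^ i) * δ₁ (suc n ∸ i)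
      last-vanishes : f (suc n) ≡ 0ℚ
      last-vanishes = trans (cong (λ e → fromℕ ((suc n C suc n) ℕ.* x ^ suc n) * δ₁ e) (ℕ.n∸n≡0 n))
                            (*-zeroʳ (fromℕ ((suc n C suc n) ℕ.* x ^ suc n)))
      vanish : ∀ i → i < n → f i ≡ 0ℚ
      vanish i i<n = trans (cong (λ e → fromℕ ((suc n C i) ℕ.* x ^ i) * δ₁ e) n+1-i≡2+m) (*-zeroʳ (fromℕ ((suc n C i) ℕ.* x ^ i)))
        where
        n+1-i≡2+m : suc n ∸ i ≡ suc (suc (n ∸ suc i))
        n+1-i≡2+m = trans (ℕ.+-∸-assoc 1 (ℕ.<⇒≤ i<n)) (cong suc (ℕ.+-∸-assoc 1 i<n))

    bernoulliPoly-zero : ∀ N → bernoulliPoly N 0 ≡ B N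
    bernoulliPoly-zero N = begin
      ∑[ k < N ] (fromℕ ((N C k) ℕ.* 0 ^ (N ∸ k)) * B k) + fromℕ ((N C N) ℕ.* 0 ^ (N ∸ N)) * B N
        ≡⟨ cong₂ (λ s c → s + fromℕ c * B N) (Σ-zero N vanish) (cong₂ (λ c e → c ℕ.* 0 ^ e) (nCn≡1 N) (ℕ.n∸n≡0 N)) ⟩
      0ℚ + 1ℚ * B N
        ≡⟨ trans (+-identityˡ _) (*-identityˡ (B N)) ⟩
      B N ∎
      where
      vanish : ∀ k → k < N → fromℕ ((N C k) ℕ.* 0 ^ (N ∸ k)) * B k ≡ 0ℚ
      vanish k k<N = begin
        fromℕ ((N C k) ℕ.* 0 ^ (N ∸ k)) * B k        ≡⟨ cong (λ e → fromℕ ((N C k) ℕ.* 0 ^ e) * B k) (ℕ.+-∸-assoc 1 k<N) ⟩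
        fromℕ ((N C k) ℕ.* 0) * B k                  ≡⟨ cong (λ n → fromℕ n * B k) (ℕ.*-zeroʳ (N C k)) ⟩
        0ℚ * B k                                     ≡⟨ *-zeroˡ (B k) ⟩
        0ℚ                                           ∎

  faulhaber : ∀ n m → bernoulliPoly (suc n) m ≡ B (suc n) + fromℕ (suc n ℕ.* powerSum n m)
  faulhaber n zero = begin
    bernoulliPoly (suc n) 0                ≡⟨ bernoulliPoly-zero (suc n) ⟩
    B (suc n)                              ≡⟨ +-identityʳ (B (suc n)) ⟨
    B (suc n) + 0ℚ                         ≡⟨ cong (λ k → B (suc n) + fromℕ k) (ℕ.*-zeroʳ (suc n)) ⟨
    B (suc n) + fromℕ (suc n ℕ.* 0)        ∎
  faulhaber n (suc m) = begin
    bernoulliPoly (suc n) (suc m)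
      ≡⟨ bernoulliPoly-suc (suc n) m ⟩
    bernoulliPoly (suc n) m + ∑[ i < suc (suc n) ] (fromℕ ((suc n C i) ℕ.* m ^ i) * δ₁ (suc n ∸ i))
      ≡⟨ cong₂ _+_ (faulhaber n m) (δ₁-sum n m) ⟩
    B (suc n) + fromℕ (suc n ℕ.* powerSum n m) + fromℕ (suc n ℕ.* m ^ n)
      ≡⟨ +-assoc (B (suc n)) _ _ ⟩
    B (suc n) + (fromℕ (suc n ℕ.* powerSum n m) + fromℕ (suc n ℕ.* m ^ n))
      ≡⟨ cong (B (suc n) +_) (fromℕ-+ (suc n ℕ.* powerSum n m) (suc n ℕ.* m ^ n)) ⟨
    B (suc n) + fromℕ (suc n ℕ.* powerSum n m ℕ.+ suc n ℕ.* m ^ n)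
      ≡⟨ cong (λ k → B (suc n) + fromℕ k) (ℕ.*-distribˡ-+ (suc n) (powerSum n m) (m ^ n)) ⟨
    B (suc n) + fromℕ (suc n ℕ.* powerSum n (suc m)) ∎

  powerQuotient : ℕ → ℕ → ℚ
  powerQuotient q e = fromℕ (q ^ e) * 1/suc e

  faulhaberTerm : ℕ → ℕ → ℕ → ℚ
  faulhaberTerm n q k = fromℕ (n C k) * (fromℕ q * B k) * powerQuotient q (n ∸ k)

  private
    faulhaberTerm-scaled : ∀ n q k → k ≤ n →
                           fromℕ ((suc n C k) ℕ.* q ^ (suc n ∸ k)) * B k ≡ fromℕ (suc n) * faulhaberTerm n q k
    faulhaberTerm-scaled n q k k≤n = begin
      fromℕ ((suc n C k) ℕ.* q ^ (suc n ∸ k)) * B k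
        ≡⟨ cong (λ e → fromℕ ((suc n C k) ℕ.* q ^ e) * B k) n+1-k≡ ⟩
      fromℕ ((suc n C k) ℕ.* q ^ suc e) * B k
        ≡⟨ cong (_* B k) (trans (cong (fromℕ ((suc n C k) ℕ.* q ^ suc e) *_) (fromℕ-*-1/suc e))
                                (*-identityʳ (fromℕ ((suc n C k) ℕ.* q ^ suc e)))) ⟨
      fromℕ ((suc n C k) ℕ.* q ^ suc e) * (fromℕ (suc e) * 1/suc e) * B k
        ≡⟨ cong (λ x → x * B k) (*-assoc (fromℕ ((suc n C k) ℕ.* q ^ suc e)) (fromℕ (suc e)) (1/suc e)) ⟨
      fromℕ ((suc n C k) ℕ.* q ^ suc e) * fromℕ (suc e) * 1/suc e * B k
        ≡⟨ cong (λ x → x * 1/suc e * B k) (fromℕ-* ((suc n C k) ℕ.* q ^ suc e) (suc e)) ⟨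
      fromℕ ((suc n C k) ℕ.* q ^ suc e ℕ.* suc e) * 1/suc e * B k
        ≡⟨ cong (λ x → fromℕ x * 1/suc e * B k) absorb ⟩
      fromℕ (suc n ℕ.* (n C k) ℕ.* (q ℕ.* q ^ e)) * 1/suc e * B k
        ≡⟨ cong (λ x → x * 1/suc e * B k) (trans (fromℕ-* (suc n ℕ.* (n C k)) (q ℕ.* q ^ e))
                                                 (cong₂ _*_ (fromℕ-* (suc n) (n C k)) (fromℕ-* q (q ^ e)))) ⟩
      fromℕ (suc n) * fromℕ (n C k) * (fromℕ q * fromℕ (q ^ e)) * 1/suc e * B k
        ≡⟨ solve 6 (λ s c r p i b → s :* c :* (r :* p) :* i :* b := s :* (c :* (r :* b) :* (p :* i)))
                 refl (fromℕ (suc n)) (fromℕ (n C k)) (fromℕ q) (fromℕ (q ^ e)) (1/suc e) (B k) ⟩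
      fromℕ (suc n) * faulhaberTerm n q k ∎
      where
      e = n ∸ k
      n+1-k≡ : suc n ∸ k ≡ suc e
      n+1-k≡ = ℕ.+-∸-assoc 1 k≤n
      absorb : (suc n C k) ℕ.* q ^ suc e ℕ.* suc e ≡ suc n ℕ.* (n C k) ℕ.* (q ℕ.* q ^ e)
      absorb = begin
        (suc n C k) ℕ.* q ^ suc e ℕ.* suc e   ≡⟨ xy∙z≈xz∙y (suc n C k) (q ^ suc e) (suc e) ⟩
        (suc n C k) ℕ.* suc e ℕ.* q ^ suc e   ≡⟨ cong (λ m → (suc n C k) ℕ.* m ℕ.* q ^ suc e) n+1-k≡ ⟨
        (suc n C k) ℕ.* (suc n ∸ k) ℕ.* q ^ suc e ≡⟨ cong (ℕ._* q ^ suc e) (C-absorption n k) ⟩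
        suc n ℕ.* (n C k) ℕ.* (q ℕ.* q ^ e)   ∎

  powerSum-bernoulli : ∀ n q → fromℕ (powerSum n q) ≡ ∑[ k < n ] faulhaberTerm n q k + fromℕ q * B n
  powerSum-bernoulli n q = *-cancelˡ-fromℕ (suc n) (begin
    fromℕ (suc n) * fromℕ (powerSum n q)
      ≡⟨ fromℕ-* (suc n) (powerSum n q) ⟨
    fromℕ (suc n ℕ.* powerSum n q)
      ≡⟨ +-cancelˡ (B (suc n)) _ _ (trans (sym (faulhaber n q)) split-last) ⟩
    ∑[ k < suc n ] (fromℕ ((suc n C k) ℕ.* q ^ (suc n ∸ k)) * B k)
      ≡⟨ Σ-cong (suc n) (λ k k<1+n → faulhaberTerm-scaled n q k (ℕ.s≤s⁻¹ k<1+n)) ⟩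
    ∑[ k < suc n ] (fromℕ (suc n) * faulhaberTerm n q k)
      ≡⟨ *-distribˡ-Σ (fromℕ (suc n)) _ (suc n) ⟨
    fromℕ (suc n) * (∑[ k < n ] faulhaberTerm n q k + faulhaberTerm n q n)
      ≡⟨ cong (λ t → fromℕ (suc n) * (∑[ k < n ] faulhaberTerm n q k + t)) last-term ⟩
    fromℕ (suc n) * (∑[ k < n ] faulhaberTerm n q k + fromℕ q * B n) ∎)
    where
    open import Algebra.Properties.Group +-0-group using () renaming (∙-cancelˡ to +-cancelˡ)
    split-last : bernoulliPoly (suc n) q ≡ B (suc n) + ∑[ k < suc n ] (fromℕ ((suc n C k) ℕ.* q ^ (suc n ∸ k)) * B k)
    split-last = begin
      T + fromℕ ((suc n C suc n) ℕ.* q ^ (n ∸ n)) * B (suc n)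
        ≡⟨ cong₂ (λ c e → T + fromℕ (c ℕ.* q ^ e) * B (suc n)) (nCn≡1 (suc n)) (ℕ.n∸n≡0 n) ⟩
      T + 1ℚ * B (suc n)
        ≡⟨ cong (T +_) (*-identityˡ (B (suc n))) ⟩
      T + B (suc n)
        ≡⟨ +-comm T (B (suc n)) ⟩
      B (suc n) + T                                           ∎
      where T = ∑[ k < suc n ] (fromℕ ((suc n C k) ℕ.* q ^ (suc n ∸ k)) * B k)
    last-term : faulhaberTerm n q n ≡ fromℕ q * B n
    last-term = begin
      fromℕ (n C n) * (fromℕ q * B n) * (fromℕ (q ^ (n ∸ n)) * 1/suc (n ∸ n))
        ≡⟨ cong₂ (λ c e → fromℕ c * (fromℕ q * B n) * (fromℕ (q ^ e) * 1/suc e)) (nCn≡1 n) (ℕ.n∸n≡0 n) ⟩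
      1ℚ * (fromℕ q * B n) * (1ℚ * 1ℚ)
        ≡⟨ solve 1 (λ y → con 1ℚ :* y :* (con 1ℚ :* con 1ℚ) := y) refl (fromℕ q * B n) ⟩
      fromℕ q * B n ∎

module Valuation where

  open import Data.Integer.Base as ℤ using (ℤ; +_)
  open import Data.Nat.Base as ℕ using (ℕ; zero; suc; _^_; _≤_; _<_; NonZero)
  import Data.Nat.Properties as ℕ
  open import Data.Nat.Divisibility using (_∣_; divides; _∣?_; ∣1⇒≡1)
  open import Data.Nat.Induction using (<-rec)
  open import Data.Nat.Primality using (Prime; euclidsLemma; ¬prime[1]; prime⇒nonZero)
  open import Data.Product.Base using (∃₂; _×_; _,_)
  open import Data.Rational.Base using (ℚ; 0ℚ; -_; _+_; _*_)
  open import Data.Rational.Properties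
  open import Data.Rational.Solver using (module +-*-Solver)
  open import Data.Sum.Base using (inj₁; inj₂)
  open import Relation.Nullary.Decidable.Core using (yes; no)
  open import Relation.Nullary.Negation using (¬_; contradiction)
  open import Relation.Binary.PropositionalEquality
  open RationalArithmetic
  open import Algebra.Properties.CommutativeSemigroup ℕ.*-commutativeSemigroup using (xy∙z≈zx∙y)

  open +-*-Solver using (solve; _:+_; _:*_; :-_; _:=_; con)
  open ≡-Reasoning

  power-decomposition : ∀ {q} → 1 < q → ∀ m → .{{NonZero m}} → ∃₂ λ v u → m ≡ q ^ v ℕ.* u × ¬ q ∣ u
  power-decomposition {q} 1<q = <-rec _ decompose
    where
    decompose : ∀ m → (∀ {k} → k < m → .{{NonZero k}} → ∃₂ λ v u → k ≡ q ^ v ℕ.* u × ¬ q ∣ u) →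
                .{{NonZero m}} → ∃₂ λ v u → m ≡ q ^ v ℕ.* u × ¬ q ∣ u
    decompose m rec with q ∣? m
    ... | no q∤m = 0 , m , sym (ℕ.+-identityʳ m) , q∤m
    ... | yes (divides k m≡kq) with rec k<m
      where
      instance
        k≢0 : NonZero k
        k≢0 = ℕ.≢-nonZero λ { refl → ℕ.≢-nonZero⁻¹ m m≡kq }
      k<m : k < m
      k<m = subst (k <_) (sym m≡kq) (ℕ.m<m*n k q 1<q)
    ... | v , u , k≡qᵛu , q∤u = suc v , u , (begin
      m                   ≡⟨ m≡kq ⟩
      k ℕ.* q             ≡⟨ cong (ℕ._* q) k≡qᵛu ⟩
      q ^ v ℕ.* u ℕ.* q   ≡⟨ xy∙z≈zx∙y (q ^ v) u q ⟩
      q ℕ.* q ^ v ℕ.* u   ∎) , q∤u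

  3+n<2^[2+n] : ∀ n → 3 ℕ.+ n < 2 ^ (2 ℕ.+ n)
  3+n<2^[2+n] zero = ℕ.≤-refl
  3+n<2^[2+n] (suc n) = ℕ.≤-trans (ℕ.≤-reflexive (ℕ.+-comm 1 (4 ℕ.+ n)))
                                  (ℕ.+-mono-≤ (3+n<2^[2+n] n) (ℕ.≤-trans (ℕ.m^n>0 2 (2 ℕ.+ n)) (ℕ.m≤m+n _ 0)))

  exponent-bound : ∀ {q v} n → 1 < q → q ^ v ≤ 3 ℕ.+ n → v ≤ suc n
  exponent-bound {q} {v} n 1<q qᵛ≤3+n with v ℕ.≤? suc n
  ... | yes v≤1+n = v≤1+n
  ... | no v≰1+n = contradiction (ℕ.≤-trans (3+n<2^[2+n] n) 2^[2+n]≤qᵛ) (ℕ.≤⇒≯ qᵛ≤3+n)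
    where
    instance _ = ℕ.>-nonZero (ℕ.<-trans ℕ.0<1+n 1<q)
    2^[2+n]≤qᵛ : 2 ^ (2 ℕ.+ n) ≤ q ^ v
    2^[2+n]≤qᵛ = ℕ.≤-trans (ℕ.^-monoˡ-≤ (2 ℕ.+ n) 1<q) (ℕ.^-monoʳ-≤ q (ℕ.≰⇒> v≰1+n))

  -- ν_q(x) ≥ e, witnessed by  x · d = a · q ^ e  with  q ∤ d  (stored as d = suc d-1).
  record Val≥ (q e : ℕ) (x : ℚ) : Set where
    constructor val≥
    field
      numerator : ℤ
      denominator-1 : ℕ
      q∤denominator : ¬ q ∣ suc denominator-1
      scaled : x * fromℕ (suc denominator-1) ≡ fromℤ numerator * fromℕ (q ^ e)

  module _ {q : ℕ} (q-prime : Prime q) where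

    private
      q∤product : ∀ {b d} → ¬ q ∣ suc b → ¬ q ∣ suc d → ¬ q ∣ suc b ℕ.* suc d
      q∤product {b} {d} q∤b q∤d q∣bd with euclidsLemma (suc b) (suc d) q-prime q∣bd
      ... | inj₁ q∣b = q∤b q∣b
      ... | inj₂ q∣d = q∤d q∣d

      q∤1 : ¬ q ∣ 1
      q∤1 q∣1 = ¬prime[1] (subst Prime (∣1⇒≡1 q∣1) q-prime)

    Val≥-multiple : ∀ e a → Val≥ q e (fromℤ a * fromℕ (q ^ e))
    Val≥-multiple e a = val≥ a 0 q∤1 (*-identityʳ _)

    Val≥-fromℕ : ∀ m → Val≥ q 0 (fromℕ m)
    Val≥-fromℕ m = subst (Val≥ q 0) (*-identityʳ (fromℕ m)) (Val≥-multiple 0 (+ m))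

    Val≥-0 : ∀ e → Val≥ q e 0ℚ
    Val≥-0 e = subst (Val≥ q e) (*-zeroˡ (fromℕ (q ^ e))) (Val≥-multiple e (+ 0))

    Val≥-∣ : ∀ {m} → q ∣ m → Val≥ q 1 (fromℕ m)
    Val≥-∣ {m} (divides k m≡kq) = subst (Val≥ q 1) (sym (begin
      fromℕ m                     ≡⟨ cong fromℕ (trans m≡kq (cong (k ℕ.*_) (sym (ℕ.*-identityʳ q)))) ⟩
      fromℕ (k ℕ.* q ^ 1)         ≡⟨ fromℕ-* k (q ^ 1) ⟩
      fromℕ k * fromℕ (q ^ 1)     ∎)) (Val≥-multiple 1 (+ k))

    Val≥-+ : ∀ {e x y} → Val≥ q e x → Val≥ q e y → Val≥ q e (x + y)
    Val≥-+ {e} {x} {y} (val≥ a b q∤b x≡) (val≥ c d q∤d y≡) =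
      val≥ (a ℤ.* + suc d ℤ.+ c ℤ.* + suc b) (d ℕ.+ b ℕ.* suc d) (q∤product q∤b q∤d) (begin
        (x + y) * fromℕ (suc b ℕ.* suc d)
          ≡⟨ cong ((x + y) *_) (fromℕ-* (suc b) (suc d)) ⟩
        (x + y) * (fromℕ (suc b) * fromℕ (suc d))
          ≡⟨ solve 4 (λ x y b d → (x :+ y) :* (b :* d) := x :* b :* d :+ y :* d :* b) refl x y (fromℕ (suc b)) (fromℕ (suc d)) ⟩
        x * fromℕ (suc b) * fromℕ (suc d) + y * fromℕ (suc d) * fromℕ (suc b)
          ≡⟨ cong₂ (λ s t → s * fromℕ (suc d) + t * fromℕ (suc b)) x≡ y≡ ⟩
        fromℤ a * Q * fromℕ (suc d) + fromℤ c * Q * fromℕ (suc b)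
          ≡⟨ solve 5 (λ a c Q d b → a :* Q :* d :+ c :* Q :* b := (a :* d :+ c :* b) :* Q) refl (fromℤ a) (fromℤ c) Q (fromℕ (suc d)) (fromℕ (suc b)) ⟩
        (fromℤ a * fromℤ (+ suc d) + fromℤ c * fromℤ (+ suc b)) * Q
          ≡⟨ cong (_* Q) (trans (fromℤ-+ (a ℤ.* + suc d) (c ℤ.* + suc b)) (cong₂ _+_ (fromℤ-* a (+ suc d)) (fromℤ-* c (+ suc b)))) ⟨
        fromℤ (a ℤ.* + suc d ℤ.+ c ℤ.* + suc b) * Q ∎)
      where Q = fromℕ (q ^ e)

    Val≥-* : ∀ {e f x y} → Val≥ q e x → Val≥ q f y → Val≥ q (e ℕ.+ f) (x * y)
    Val≥-* {e} {f} {x} {y} (val≥ a b q∤b x≡) (val≥ c d q∤d y≡) =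
      val≥ (a ℤ.* c) (d ℕ.+ b ℕ.* suc d) (q∤product q∤b q∤d) (begin
        x * y * fromℕ (suc b ℕ.* suc d)
          ≡⟨ cong (x * y *_) (fromℕ-* (suc b) (suc d)) ⟩
        x * y * (fromℕ (suc b) * fromℕ (suc d))
          ≡⟨ solve 4 (λ x y b d → x :* y :* (b :* d) := x :* b :* (y :* d)) refl x y (fromℕ (suc b)) (fromℕ (suc d)) ⟩
        x * fromℕ (suc b) * (y * fromℕ (suc d))
          ≡⟨ cong₂ _*_ x≡ y≡ ⟩
        fromℤ a * fromℕ (q ^ e) * (fromℤ c * fromℕ (q ^ f))
          ≡⟨ solve 4 (λ a Q c P → a :* Q :* (c :* P) := a :* c :* (Q :* P)) refl (fromℤ a) (fromℕ (q ^ e)) (fromℤ c) (fromℕ (q ^ f)) ⟩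
        fromℤ a * fromℤ c * (fromℕ (q ^ e) * fromℕ (q ^ f))
          ≡⟨ cong₂ _*_ (fromℤ-* a c) (trans (cong fromℕ (ℕ.^-distribˡ-+-* q e f)) (fromℕ-* (q ^ e) (q ^ f))) ⟨
        fromℤ (a ℤ.* c) * fromℕ (q ^ (e ℕ.+ f)) ∎)

    Val≥-neg : ∀ {e x} → Val≥ q e x → Val≥ q e (- x)
    Val≥-neg {e} {x} (val≥ a b q∤b x≡) = val≥ (ℤ.- a) b q∤b (begin
      - x * fromℕ (suc b)             ≡⟨ neg-distribˡ-* x (fromℕ (suc b)) ⟨
      - (x * fromℕ (suc b))           ≡⟨ cong -_ x≡ ⟩
      - (fromℤ a * fromℕ (q ^ e))     ≡⟨ neg-distribˡ-* (fromℤ a) (fromℕ (q ^ e)) ⟩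
      - fromℤ a * fromℕ (q ^ e)       ≡⟨ cong (_* fromℕ (q ^ e)) (fromℤ-neg a) ⟨
      fromℤ (ℤ.- a) * fromℕ (q ^ e)   ∎)

    Val≥-weaken : ∀ {e x} → Val≥ q (suc e) x → Val≥ q e x
    Val≥-weaken {e} {x} (val≥ a b q∤b x≡) = val≥ (a ℤ.* + q) b q∤b (begin
      x * fromℕ (suc b)                   ≡⟨ x≡ ⟩
      fromℤ a * fromℕ (q ℕ.* q ^ e)       ≡⟨ cong (fromℤ a *_) (fromℕ-* q (q ^ e)) ⟩
      fromℤ a * (fromℕ q * fromℕ (q ^ e)) ≡⟨ *-assoc (fromℤ a) (fromℕ q) (fromℕ (q ^ e)) ⟨
      fromℤ a * fromℕ q * fromℕ (q ^ e)   ≡⟨ cong (_* fromℕ (q ^ e)) (fromℤ-* a (+ q)) ⟨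
      fromℤ (a ℤ.* + q) * fromℕ (q ^ e)   ∎)

    Val≥-divide : ∀ {e x} → Val≥ q (suc e) (fromℕ q * x) → Val≥ q e x
    Val≥-divide {e} {x} (val≥ a b q∤b qx≡) = val≥ a b q∤b (*-cancelˡ-fromℕ q {{prime⇒nonZero q-prime}} (begin
      fromℕ q * (x * fromℕ (suc b))
        ≡⟨ *-assoc (fromℕ q) x (fromℕ (suc b)) ⟨
      fromℕ q * x * fromℕ (suc b)
        ≡⟨ qx≡ ⟩
      fromℤ a * fromℕ (q ℕ.* q ^ e)
        ≡⟨ cong (fromℤ a *_) (fromℕ-* q (q ^ e)) ⟩
      fromℤ a * (fromℕ q * fromℕ (q ^ e))
        ≡⟨ solve 3 (λ a q Q → a :* (q :* Q) := q :* (a :* Q)) refl (fromℤ a) (fromℕ q) (fromℕ (q ^ e)) ⟩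
      fromℕ q * (fromℤ a * fromℕ (q ^ e)) ∎))

    Val≥-Σ : ∀ {e} f n → (∀ k → k < n → Val≥ q e (f k)) → Val≥ q e (Σ f n)
    Val≥-Σ {e} f = Σ-closed {P = Val≥ q e} (Val≥-0 e) Val≥-+

module Denominator where

  open import Data.Integer.Base as ℤ using (ℤ; +_)
  import Data.Integer.Properties as ℤ
  import Data.Integer.Divisibility.Signed as ℤ
  open import Data.Nat.Base as ℕ using (ℕ; zero; suc; _^_)
  import Data.Nat.Properties as ℕ
  open import Data.Nat.Coprimality as Coprimality using (Coprime; coprime-divisor)
  open import Data.Nat.Divisibility using (_∣_; divides; ∣-refl; ∣-trans)
  open import Data.Nat.ListAction using (product)
  open import Data.Nat.Primality using (Prime)
  open import Data.Nat.Primality.Factorisation using (factorise)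
  open import Data.List.Base using ([]; _∷_)
  open import Data.List.Relation.Unary.All using (_∷_)
  open import Data.Product.Base using (_,_)
  open import Data.Rational.Base
  open import Data.Rational.Properties using (fromℚᵘ-cong; /-injective-≃; *-identityˡ; *-identityʳ; *-comm; normalize-coprime)
  import Data.Rational.Unnormalised.Base as ℚᵘ
  open import Relation.Nullary.Negation using (¬_; contradiction)
  open import Relation.Binary.PropositionalEquality
  open RationalArithmetic
  open Valuation

  open ≡-Reasoning

  private
    /-cong-cross : ∀ a b c d → a ℤ.* + suc d ≡ c ℤ.* + suc b → a / suc b ≡ c / suc d
    /-cong-cross a b c d eq = fromℚᵘ-cong {ℚᵘ.mkℚᵘ a b} {ℚᵘ.mkℚᵘ c d} (ℚᵘ.*≡* eq)

    /-cross : ∀ a b c d → a / suc b ≡ c / suc d → a ℤ.* + suc d ≡ c ℤ.* + suc b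
    /-cross a b c d eq with /-injective-≃ (ℚᵘ.mkℚᵘ a b) (ℚᵘ.mkℚᵘ c d) eq
    ... | ℚᵘ.*≡* cross = cross

  *-denominator : ∀ y → y * fromℕ (↧ₙ y) ≡ fromℤ (↥ y)
  *-denominator y@(mkℚ n d-1 _) = begin
    y * fromℕ (suc d-1)                          ≡⟨ cong (y *_) (fromℤ-mkℚ (+ suc d-1)) ⟩
    (n ℤ.* + suc d-1) / suc (d-1 ℕ.* 1)          ≡⟨ /-cong-cross (n ℤ.* + suc d-1) (d-1 ℕ.* 1) n 0 cross ⟩
    fromℤ n                                      ∎
    where
    cross : n ℤ.* + suc d-1 ℤ.* + 1 ≡ n ℤ.* + suc (d-1 ℕ.* 1)
    cross = trans (ℤ.*-identityʳ (n ℤ.* + suc d-1)) (cong (λ m → n ℤ.* + suc m) (sym (ℕ.*-identityʳ d-1)))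

  denominator-∣ : ∀ y {u a} → y * fromℕ (suc u) ≡ fromℤ a → ↧ₙ y ∣ suc u
  denominator-∣ y@(mkℚ n d-1 coprime) {u} {a} y*u≡a =
    coprime-divisor (Coprimality.sym (Coprimality.recompute coprime)) (divides ℤ.∣ a ∣ (begin
      ℤ.∣ n ∣ ℕ.* suc u                         ≡⟨ ℤ.abs-* n (+ suc u) ⟨
      ℤ.∣ n ℤ.* + suc u ∣                       ≡⟨ cong ℤ.∣_∣ (ℤ.*-identityʳ (n ℤ.* + suc u)) ⟨
      ℤ.∣ n ℤ.* + suc u ℤ.* + 1 ∣               ≡⟨ cong ℤ.∣_∣ (/-cross (n ℤ.* + suc u) (d-1 ℕ.* 1) a 0 y*u/1≡a) ⟩
      ℤ.∣ a ℤ.* + suc (d-1 ℕ.* 1) ∣             ≡⟨ ℤ.abs-* a (+ suc (d-1 ℕ.* 1)) ⟩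
      ℤ.∣ a ∣ ℕ.* suc (d-1 ℕ.* 1)               ≡⟨ cong (λ m → ℤ.∣ a ∣ ℕ.* suc m) (ℕ.*-identityʳ d-1) ⟩
      ℤ.∣ a ∣ ℕ.* suc d-1                       ∎))
    where
    y*u/1≡a : (n ℤ.* + suc u) / suc (d-1 ℕ.* 1) ≡ a / 1
    y*u/1≡a = trans (cong (y *_) (sym (fromℤ-mkℚ (+ suc u)))) y*u≡a

  Val≥⇒∤denominator : ∀ {ℓ y} → Val≥ ℓ 0 y → ¬ ℓ ∣ ↧ₙ y
  Val≥⇒∤denominator {ℓ} {y} (val≥ a b ℓ∤b y*b≡a) ℓ∣y =
    ℓ∤b (∣-trans ℓ∣y (denominator-∣ y {a = a} (trans y*b≡a (*-identityʳ (fromℤ a)))))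

  ∤denominator⇒Val≥ : ∀ {ℓ y} → ¬ ℓ ∣ ↧ₙ y → Val≥ ℓ 0 y
  ∤denominator⇒Val≥ {ℓ} {y@(mkℚ n d-1 _)} ℓ∤y = val≥ n d-1 ℓ∤y (trans (*-denominator y) (sym (*-identityʳ (fromℤ n))))

  private
    ↧ₙ-/-coprime : ∀ i d-1 → .(Coprime ℤ.∣ i ∣ (suc d-1)) → ↧ₙ (i / suc d-1) ≡ suc d-1
    ↧ₙ-/-coprime (+ n) d-1 coprime = cong ↧ₙ_ (normalize-coprime coprime)
    ↧ₙ-/-coprime ℤ.-[1+ n ] d-1 coprime = cong (λ x → ↧ₙ (- x)) (normalize-coprime coprime)

  ↧ₙ-fromℤ-+ : ∀ z x → ↧ₙ (fromℤ z + x) ≡ ↧ₙ x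
  ↧ₙ-fromℤ-+ z x@(mkℚ n d-1 coprime) = begin
    ↧ₙ (fromℤ z + x)
      ≡⟨ cong (λ w → ↧ₙ (w + x)) (fromℤ-mkℚ z) ⟩
    ↧ₙ ((z ℤ.* + d ℤ.+ n ℤ.* + 1) / suc (d-1 ℕ.+ 0))
      ≡⟨ cong (λ m → ↧ₙ ((z ℤ.* + d ℤ.+ n ℤ.* + 1) / suc m)) (ℕ.+-identityʳ d-1) ⟩
    ↧ₙ ((z ℤ.* + d ℤ.+ n ℤ.* + 1) / d)
      ≡⟨ ↧ₙ-/-coprime (z ℤ.* + d ℤ.+ n ℤ.* + 1) d-1 shifted-coprime ⟩
    d ∎
    where
    d = suc d-1
    shifted-coprime : Coprime ℤ.∣ z ℤ.* + d ℤ.+ n ℤ.* + 1 ∣ d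
    shifted-coprime {k} (k∣zd+n , k∣d) = Coprimality.recompute coprime (k∣n , k∣d)
      where
      k∣n : k ∣ ℤ.∣ n ∣
      k∣n = subst (λ m → k ∣ ℤ.∣ m ∣) (ℤ.*-identityʳ n)
              (ℤ.∣⇒∣ᵤ (ℤ.∣m+n∣m⇒∣n (ℤ.∣ᵤ⇒∣ {+ k} k∣zd+n) (ℤ.∣n⇒∣m*n z (ℤ.∣ᵤ⇒∣ {+ k} {+ d} k∣d))))

  integral-everywhere⇒integer : ∀ y → (∀ ℓ → Prime ℓ → Val≥ ℓ 0 y) → y ≡ fromℤ (↥ y)
  integral-everywhere⇒integer (mkℚ n zero _) integral = sym (fromℤ-mkℚ n)
  integral-everywhere⇒integer y@(mkℚ n (suc d-2) _) integral with factorise (↧ₙ y)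
  ... | record { factors = [] ; isFactorisation = () }
  ... | record { factors = ℓ ∷ ℓs ; isFactorisation = y≡ℓ*ℓs ; factorsPrime = ℓ-prime ∷ _ } =
    contradiction (divides (product ℓs) (trans y≡ℓ*ℓs (ℕ.*-comm ℓ (product ℓs))))
                  (Val≥⇒∤denominator (integral ℓ ℓ-prime))

  module _ {q-1 : ℕ} (q-prime : Prime (suc q-1)) where

    ¬Val≥-1/q : ¬ Val≥ (suc q-1) 0 (1/suc q-1)
    ¬Val≥-1/q val = ¬Val≥1-1 (subst (Val≥ q 1) (fromℕ-*-1/suc q-1) (Val≥-* q-prime (Val≥-∣ q-prime ∣-refl) val))
      where
      q = suc q-1
      ¬Val≥1-1 : ¬ Val≥ q 1 1ℚ
      ¬Val≥1-1 (val≥ a b q∤b b≡a*q) = q∤b (divides ℤ.∣ a ∣ (begin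
        suc b                   ≡⟨ cong ℤ.∣_∣ (fromℤ-injective {+ suc b} {a ℤ.* + q ^ 1} b≡a*qᵢ) ⟩
        ℤ.∣ a ℤ.* + q ^ 1 ∣     ≡⟨ ℤ.abs-* a (+ q ^ 1) ⟩
        ℤ.∣ a ∣ ℕ.* q ^ 1       ≡⟨ cong (ℤ.∣ a ∣ ℕ.*_) (ℕ.*-identityʳ q) ⟩
        ℤ.∣ a ∣ ℕ.* q           ∎))
        where
        b≡a*qᵢ : fromℕ (suc b) ≡ fromℤ (a ℤ.* + q ^ 1)
        b≡a*qᵢ = trans (sym (*-identityˡ (fromℕ (suc b)))) (trans b≡a*q (sym (fromℤ-* a (+ q ^ 1))))

module StaudtClausen where

  open import Data.Integer.Base using (+_)
  open import Data.Nat.Base as ℕ using (ℕ; zero; suc; _∸_; _^_; _≤_; _<_; s≤s; NonZero)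
  import Data.Nat.Properties as ℕ
  open import Data.Nat.Combinatorics using (_C_)
  open import Data.Nat.Divisibility using (_∣_; ∣⇒≤)
  open import Data.Nat.Induction using (<-rec)
  open import Data.Nat.Primality using (Prime; prime⇒nonTrivial)
  open import Data.Product.Base using (_,_)
  open import Data.Rational.Base using (1ℚ; -_; _+_; _*_)
  open import Data.Rational.Properties using (*-identityʳ; *-assoc; *-comm; *-distribˡ-+)
  open import Data.Rational.Solver using (module +-*-Solver)
  open import Relation.Nullary.Decidable.Core using (yes; no)
  open import Relation.Nullary.Negation using (¬_; contradiction)
  open import Relation.Binary.PropositionalEquality
  open import Defs using (B)
  open RationalArithmetic
  open Valuation
  open Faulhaber
  open PowerSum using (powerSum; powerSum-multiple; powerSum-nonmultiple)
  open Binomial using ([1+n]Cn≡1+n)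

  open +-*-Solver using (solve; _:+_; _:*_; :-_; _:=_; con)
  open ≡-Reasoning

  module _ {q : ℕ} (q-prime : Prime q) where

    private
      1<q : 1 < q
      1<q = ℕ.nonTrivial⇒n>1 q {{prime⇒nonTrivial q-prime}}

    powerQuotient-Val≥1 : ∀ e → Val≥ q 1 (powerQuotient q (2 ℕ.+ e))
    powerQuotient-Val≥1 e with power-decomposition 1<q (3 ℕ.+ e)
    ... | v , zero , 3+e≡qᵛu , _ = contradiction (trans 3+e≡qᵛu (ℕ.*-zeroʳ (q ^ v))) λ ()
    ... | v , u@(suc u-1) , 3+e≡qᵛu , q∤u = val≥ (+ q ^ w) u-1 q∤u (begin
      fromℕ (q ^ (2 ℕ.+ e)) * 1/suc (2 ℕ.+ e) * fromℕ u
        ≡⟨ cong (λ m → fromℕ m * 1/suc (2 ℕ.+ e) * fromℕ u) split ⟩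
      fromℕ (q ^ v ℕ.* q ^ suc w) * 1/suc (2 ℕ.+ e) * fromℕ u
        ≡⟨ cong (λ x → x * 1/suc (2 ℕ.+ e) * fromℕ u) (fromℕ-* (q ^ v) (q ^ suc w)) ⟩
      fromℕ (q ^ v) * fromℕ (q ^ suc w) * 1/suc (2 ℕ.+ e) * fromℕ u
        ≡⟨ solve 4 (λ a b i u → a :* b :* i :* u := b :* (a :* u :* i)) refl (fromℕ (q ^ v)) (fromℕ (q ^ suc w)) (1/suc (2 ℕ.+ e)) (fromℕ u) ⟩
      fromℕ (q ^ suc w) * (fromℕ (q ^ v) * fromℕ u * 1/suc (2 ℕ.+ e))
        ≡⟨ cong (λ x → fromℕ (q ^ suc w) * (x * 1/suc (2 ℕ.+ e))) (trans (cong fromℕ 3+e≡qᵛu) (fromℕ-* (q ^ v) u)) ⟨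
      fromℕ (q ^ suc w) * (fromℕ (3 ℕ.+ e) * 1/suc (2 ℕ.+ e))
        ≡⟨ cong (fromℕ (q ^ suc w) *_) (fromℕ-*-1/suc (2 ℕ.+ e)) ⟩
      fromℕ (q ^ suc w) * 1ℚ
        ≡⟨ *-identityʳ (fromℕ (q ^ suc w)) ⟩
      fromℕ (q ℕ.* q ^ w)
        ≡⟨ trans (cong fromℕ (trans (ℕ.*-comm q (q ^ w)) (cong (q ^ w ℕ.*_) (sym (ℕ.*-identityʳ q))))) (fromℕ-* (q ^ w) (q ^ 1)) ⟩
      fromℤ (+ q ^ w) * fromℕ (q ^ 1) ∎)
      where
      v≤1+e : v ≤ suc e
      v≤1+e = exponent-bound e 1<q (subst (q ^ v ≤_) (sym 3+e≡qᵛu) (ℕ.m≤m*n (q ^ v) u))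
      w = suc e ∸ v
      split : q ^ (2 ℕ.+ e) ≡ q ^ v ℕ.* q ^ suc w
      split = trans (cong (q ^_) (trans (cong suc (sym (ℕ.m+[n∸m]≡n v≤1+e))) (sym (ℕ.+-suc v w)))) (ℕ.^-distribˡ-+-* q v (suc w))

    powerQuotient-Val≥1-odd : q ≢ 2 → Val≥ q 1 (powerQuotient q 1)
    powerQuotient-Val≥1-odd q≢2 = val≥ (+ 1) 1 q∤2 (begin
      fromℕ (q ^ 1) * 1/suc 1 * fromℕ 2       ≡⟨ *-assoc (fromℕ (q ^ 1)) (1/suc 1) (fromℕ 2) ⟩
      fromℕ (q ^ 1) * (1/suc 1 * fromℕ 2)     ≡⟨ cong (fromℕ (q ^ 1) *_) (trans (*-comm (1/suc 1) (fromℕ 2)) (fromℕ-*-1/suc 1)) ⟩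
      fromℕ (q ^ 1) * 1ℚ                      ≡⟨ *-comm (fromℕ (q ^ 1)) 1ℚ ⟩
      fromℤ (+ 1) * fromℕ (q ^ 1)             ∎)
      where
      q∤2 : ¬ q ∣ 2
      q∤2 q∣2 = q≢2 (ℕ.≤-antisym (∣⇒≤ q∣2) 1<q)

    powerQuotient-Val≥0 : ∀ e → Val≥ q 0 (powerQuotient q e)
    powerQuotient-Val≥0 zero = Val≥-fromℕ q-prime 1
    powerQuotient-Val≥0 (suc zero) with q ℕ.≟ 2
    ... | yes refl = Val≥-fromℕ q-prime 1
    ... | no q≢2 = Val≥-weaken q-prime (powerQuotient-Val≥1-odd q≢2)
    powerQuotient-Val≥0 (suc (suc e)) = Val≥-weaken q-prime (powerQuotient-Val≥1 e)

  module _ {q-1 : ℕ} (q-prime : Prime (suc q-1)) where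

    private
      q = suc q-1

      n∸k≡1+n∸[1+k] : ∀ {n k} → k < n → n ∸ k ≡ suc (n ∸ suc k)
      n∸k≡1+n∸[1+k] {suc n} {zero} _ = refl
      n∸k≡1+n∸[1+k] {suc n} {suc k} (s≤s k<n) = n∸k≡1+n∸[1+k] k<n

      term-Val≥ : ∀ {e} n k → Val≥ q 0 (fromℕ q * B k) → Val≥ q e (powerQuotient q (n ∸ k)) → Val≥ q e (faulhaberTerm n q k)
      term-Val≥ n k qBₖ quotient = Val≥-* q-prime (Val≥-* q-prime (Val≥-fromℕ q-prime (n C k)) qBₖ) quotient

      qB-from-powerSum : ∀ n → fromℕ q * B n ≡ fromℕ (powerSum n q) + - ∑[ k < n ] faulhaberTerm n q k
      qB-from-powerSum n = trans (solve 2 (λ t b → b := t :+ b :+ (:- t)) refl T (fromℕ q * B n))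
                                 (cong (_+ - T) (sym (powerSum-bernoulli n q)))
        where T = ∑[ k < n ] faulhaberTerm n q k

    qB-integral : ∀ n → Val≥ q 0 (fromℕ q * B n)
    qB-integral = <-rec _ λ n rec →
      subst (Val≥ q 0) (sym (qB-from-powerSum n))
            (Val≥-+ q-prime (Val≥-fromℕ q-prime (powerSum n q))
                            (Val≥-neg q-prime (Val≥-Σ q-prime _ n λ k k<n →
                               term-Val≥ n k (rec k<n) (powerQuotient-Val≥0 q-prime (n ∸ k)))))

    private
      faulhaberTerms-Val≥1 : ∀ m → 2 ∣ suc m → Val≥ q 1 (∑[ k < suc m ] faulhaberTerm (suc m) q k)
      faulhaberTerms-Val≥1 m 2∣1+m = Val≥-+ q-prime (Val≥-Σ q-prime _ m lower) last
        where
        lower : ∀ k → k < m → Val≥ q 1 (faulhaberTerm (suc m) q k)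
        lower k k<m = term-Val≥ (suc m) k (qB-integral k)
          (subst (λ e → Val≥ q 1 (powerQuotient q e)) (sym 1+m∸k≡2+m∸[1+k]) (powerQuotient-Val≥1 q-prime (m ∸ suc k)))
          where
          1+m∸k≡2+m∸[1+k] : suc m ∸ k ≡ 2 ℕ.+ (m ∸ suc k)
          1+m∸k≡2+m∸[1+k] = trans (n∸k≡1+n∸[1+k] (s≤s (ℕ.<⇒≤ k<m))) (cong suc (n∸k≡1+n∸[1+k] k<m))
        last : Val≥ q 1 (faulhaberTerm (suc m) q m)
        last with q ℕ.≟ 2
        ... | no q≢2 = term-Val≥ (suc m) m (qB-integral m)
          (subst (λ e → Val≥ q 1 (powerQuotient q e)) (sym (ℕ.m+n∸n≡m 1 m)) (powerQuotient-Val≥1-odd q-prime q≢2))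
        ... | yes refl = Val≥-* q-prime (Val≥-* q-prime 2∣C (qB-integral m)) (powerQuotient-Val≥0 q-prime (suc m ∸ m))
          where
          2∣C : Val≥ 2 1 (fromℕ (suc m C m))
          2∣C = subst (λ c → Val≥ 2 1 (fromℕ c)) (sym ([1+n]Cn≡1+n m)) (Val≥-∣ q-prime 2∣1+m)

    staudt-clausen-multiple : ∀ n .{{_ : NonZero n}} → 2 ∣ n → q-1 ∣ n → Val≥ q 0 (B n + 1/suc q-1)
    staudt-clausen-multiple n@(suc m) 2∣n q-1∣n = Val≥-divide q-prime (subst (Val≥ q 1) (sym rearrange)
      (Val≥-+ q-prime (Val≥-∣ q-prime (powerSum-multiple q-prime n ℕ.0<1+n q-1∣n))
                      (Val≥-neg q-prime (faulhaberTerms-Val≥1 m 2∣n))))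
      where
      T = ∑[ k < n ] faulhaberTerm n q k
      rearrange : fromℕ q * (B n + 1/suc q-1) ≡ fromℕ (powerSum n q ℕ.+ 1) + - T
      rearrange = begin
        fromℕ q * (B n + 1/suc q-1)
          ≡⟨ *-distribˡ-+ (fromℕ q) (B n) (1/suc q-1) ⟩
        fromℕ q * B n + fromℕ q * 1/suc q-1
          ≡⟨ cong₂ _+_ (qB-from-powerSum n) (fromℕ-*-1/suc q-1) ⟩
        fromℕ (powerSum n q) + - T + 1ℚ
          ≡⟨ solve 3 (λ s t o → s :+ (:- t) :+ o := s :+ o :+ (:- t)) refl (fromℕ (powerSum n q)) T 1ℚ ⟩
        fromℕ (powerSum n q) + 1ℚ + - T
          ≡⟨ cong (_+ - T) (fromℕ-+ (powerSum n q) 1) ⟨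
        fromℕ (powerSum n q ℕ.+ 1) + - T             ∎

    staudt-clausen-nonmultiple : ∀ n .{{_ : NonZero n}} → 2 ∣ n → ¬ q-1 ∣ n → Val≥ q 0 (B n)
    staudt-clausen-nonmultiple n@(suc m) 2∣n q-1∤n = Val≥-divide q-prime (subst (Val≥ q 1) (sym (qB-from-powerSum n))
      (Val≥-+ q-prime (Val≥-∣ q-prime (powerSum-nonmultiple q-prime n ℕ.0<1+n q-1∤n))
                      (Val≥-neg q-prime (faulhaberTerms-Val≥1 m 2∣n))))

module Counting where

  open import Data.List.Base using ([_]; _++_; length; filter; upTo)
  open import Data.List.Properties using (filter-++; filter-accept; filter-reject; filter-≐; upTo-∷ʳ; length-++)
  open import Data.Nat.Base using (ℕ; zero; suc; _+_; _≤_; s≤s)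
  open import Data.Nat.Properties using (+-identityʳ; +-comm; +-suc; ≤-refl; ≤-trans; n≤1+n; m≤m+n; m≤n⇒∃[o]m+o≡n)
  open import Data.Product.Base using (_,_)
  open import Function.Base using (_∘_)
  open import Relation.Nullary.Negation using (¬_)
  open import Relation.Nullary.Decidable.Core using (yes; no)
  open import Relation.Unary using (Pred; Decidable; _≐_)
  open import Relation.Binary.PropositionalEquality hiding ([_])

  open ≡-Reasoning

  module _ {p} {P : Pred ℕ p} (P? : Decidable P) where

    count : ℕ → ℕ
    count n = length (filter P? (upTo n))

    private
      count-suc : ∀ n → count (suc n) ≡ count n + length (filter P? [ n ])
      count-suc n = begin
        length (filter P? (upTo (suc n)))                ≡⟨ cong (length ∘ filter P?) (upTo-∷ʳ n) ⟨
        length (filter P? (upTo n ++ [ n ]))             ≡⟨ cong length (filter-++ P? (upTo n) [ n ]) ⟩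
        length (filter P? (upTo n) ++ filter P? [ n ])   ≡⟨ length-++ (filter P? (upTo n)) ⟩
        count n + length (filter P? [ n ])               ∎

    count-accept : ∀ {n} → P n → count (suc n) ≡ suc (count n)
    count-accept {n} Pn = trans (count-suc n) (trans (cong (λ xs → count n + length xs) (filter-accept P? Pn)) (+-comm (count n) 1))

    count-reject : ∀ {n} → ¬ P n → count (suc n) ≡ count n
    count-reject {n} ¬Pn = trans (count-suc n) (trans (cong (λ xs → count n + length xs) (filter-reject P? ¬Pn)) (+-identityʳ (count n)))

    count-mono : ∀ {m n} → m ≤ n → count m ≤ count n
    count-mono {m} {n} m≤n with m≤n⇒∃[o]m+o≡n m≤n
    ... | o , refl = grow o
      where
      grow : ∀ o → count m ≤ count (m + o)
      grow zero = subst (λ k → count m ≤ count k) (sym (+-identityʳ m)) ≤-refl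
      grow (suc o) = subst (λ k → count m ≤ count k) (sym (+-suc m o)) (≤-trans (grow o) (step (m + o)))
        where
        step : ∀ k → count k ≤ count (suc k)
        step k with P? k
        ... | yes Pk = subst (count k ≤_) (sym (count-accept Pk)) (n≤1+n (count k))
        ... | no ¬Pk = subst (count k ≤_) (sym (count-reject ¬Pk)) ≤-refl

    count-reject-range : ∀ n k → (∀ i → n ≤ i → ¬ P i) → count (n + k) ≡ count n
    count-reject-range n zero ¬P = cong count (+-identityʳ n)
    count-reject-range n (suc k) ¬P = begin
      count (n + suc k)   ≡⟨ cong count (+-suc n k) ⟩
      count (suc (n + k)) ≡⟨ count-reject (¬P (n + k) (m≤m+n n k)) ⟩
      count (n + k)       ≡⟨ count-reject-range n k ¬P ⟩
      count n             ∎

    count-accept-≥ : ∀ {m k} → P k → m ≤ count k → suc m ≤ count (suc k)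
    count-accept-≥ Pk m≤count = subst (suc _ ≤_) (sym (count-accept Pk)) (s≤s m≤count)

  count-≐ : ∀ {p q} {P : Pred ℕ p} {Q : Pred ℕ q} (P? : Decidable P) (Q? : Decidable Q) → P ≐ Q → ∀ n → count P? n ≡ count Q? n
  count-≐ P? Q? P≐Q n = cong length (filter-≐ P? Q? P≐Q (upTo n))

module FourTimesPrime where

  open import Data.Nat.Base as ℕ using (ℕ; zero; suc; _+_; _*_; _∸_; _≤_; _<_; z≤n; s≤s; NonZero)
  open import Data.Nat.Properties
  open import Data.Nat.Coprimality using (Coprime; coprime⇒gcd≡1; coprime-divisor)
  open import Data.Nat.Divisibility
  open import Data.Nat.DivMod using (_%_; _/_; m%n<n; m≡m%n+[m/n]*n)
  open import Data.Nat.GCD using (gcd)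
  open import Data.Nat.Primality using (Prime; prime?; prime⇒irreducible; ¬prime[1]; euclidsLemma)
  open import Data.Product.Base using (_,_; proj₁)
  open import Data.Rational.Base as ℚ using (ℚ; ↧ₙ_)
  open import Data.Rational.Solver using (module +-*-Solver)
  open import Data.Sum.Base using (_⊎_; inj₁; inj₂)
  open import Function.Base using (_∘_)
  open import Function.Bundles using (_⇔_; mk⇔)
  open import Relation.Nullary.Decidable.Core using (Dec; yes; no; from-yes; from-no; _⊎-dec_)
  open import Relation.Nullary.Negation using (¬_; contradiction)
  open import Relation.Binary.PropositionalEquality
  open import Defs using (Toda; toda?; t; D; B)
  open RationalArithmetic using (1/suc; fromℤ)
  open Valuation using (Val≥; Val≥-+; Val≥-neg)
  open Denominator using (∤denominator⇒Val≥; ↧ₙ-fromℤ-+; integral-everywhere⇒integer; ¬Val≥-1/q)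
  open StaudtClausen using (staudt-clausen-multiple; staudt-clausen-nonmultiple)
  open Counting

  open +-*-Solver using (solve; _:+_; :-_; _:=_)

  prime-∤⇒gcd≡1 : ∀ {q m} → Prime q → ¬ q ∣ m → gcd q m ≡ 1
  prime-∤⇒gcd≡1 {q} {m} q-prime q∤m = coprime⇒gcd≡1 coprime
    where
    coprime : Coprime q m
    coprime (d∣q , d∣m) with prime⇒irreducible q-prime d∣q
    ... | inj₁ d≡1 = d≡1
    ... | inj₂ refl = contradiction d∣m q∤m

  prime∣prime⇒≡ : ∀ {r q} → Prime r → Prime q → r ∣ q → r ≡ q
  prime∣prime⇒≡ r-prime q-prime r∣q with prime⇒irreducible q-prime r∣q
  ... | inj₁ refl = contradiction r-prime ¬prime[1]
  ... | inj₂ r≡q = r≡q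

  2∤n⇒2∣1+n : ∀ {n} → ¬ 2 ∣ n → 2 ∣ suc n
  2∤n⇒2∣1+n {n} 2∤n with n % 2 | m%n<n n 2 | m≡m%n+[m/n]*n n 2
  ... | zero | _ | n≡[n/2]*2 = contradiction (divides (n / 2) n≡[n/2]*2) 2∤n
  ... | suc zero | _ | n≡1+[n/2]*2 = divides (suc (n / 2)) (cong suc n≡1+[n/2]*2)
  ... | suc (suc _) | s≤s (s≤s ()) | _

  divisors-of-4 : ∀ {d} → d ∣ 4 → d ≡ 1 ⊎ d ≡ 2 ⊎ d ≡ 4
  divisors-of-4 {0} 0∣4 = contradiction (0∣⇒≡0 0∣4) λ ()
  divisors-of-4 {1} _ = inj₁ refl
  divisors-of-4 {2} _ = inj₂ (inj₁ refl)
  divisors-of-4 {3} 3∣4 = contradiction 3∣4 (from-no (3 ∣? 4))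
  divisors-of-4 {4} _ = inj₂ (inj₂ refl)
  divisors-of-4 {suc (suc (suc (suc (suc d))))} d∣4 = contradiction d∣4 (>⇒∤ (s≤s (s≤s (s≤s (s≤s (s≤s z≤n))))))

  prime∣30 : ∀ {ℓ} → Prime ℓ → ℓ ∣ 30 → ℓ ≡ 2 ⊎ ℓ ≡ 3 ⊎ ℓ ≡ 5
  prime∣30 ℓ-prime ℓ∣30 with euclidsLemma 2 15 ℓ-prime ℓ∣30
  ... | inj₁ ℓ∣2 = inj₁ (prime∣prime⇒≡ ℓ-prime (from-yes (prime? 2)) ℓ∣2)
  ... | inj₂ ℓ∣15 with euclidsLemma 3 5 ℓ-prime ℓ∣15
  ...   | inj₁ ℓ∣3 = inj₂ (inj₁ (prime∣prime⇒≡ ℓ-prime (from-yes (prime? 3)) ℓ∣3))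
  ...   | inj₂ ℓ∣5 = inj₂ (inj₂ (prime∣prime⇒≡ ℓ-prime (from-yes (prime? 5)) ℓ∣5))

  σ : ℚ
  σ = 1/suc 1 ℚ.+ 1/suc 2 ℚ.+ 1/suc 4

  σ-Val≥ : ∀ {ℓ} → Prime ℓ → ¬ (ℓ ≡ 2 ⊎ ℓ ≡ 3 ⊎ ℓ ≡ 5) → Val≥ ℓ 0 σ
  σ-Val≥ ℓ-prime ℓ∉235 = ∤denominator⇒Val≥ (ℓ∉235 ∘ prime∣30 ℓ-prime)

  σ-1/ℓ-Val≥ : ∀ {ℓ} → ℓ ≡ 2 ⊎ ℓ ≡ 3 ⊎ ℓ ≡ 5 → Val≥ ℓ 0 (σ ℚ.+ ℚ.- 1/suc (ℓ ∸ 1))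
  σ-1/ℓ-Val≥ (inj₁ refl) = ∤denominator⇒Val≥ (from-no (2 ∣? ↧ₙ (σ ℚ.+ ℚ.- 1/suc 1)))
  σ-1/ℓ-Val≥ (inj₂ (inj₁ refl)) = ∤denominator⇒Val≥ (from-no (3 ∣? ↧ₙ (σ ℚ.+ ℚ.- 1/suc 2)))
  σ-1/ℓ-Val≥ (inj₂ (inj₂ refl)) = ∤denominator⇒Val≥ (from-no (5 ∣? ↧ₙ (σ ℚ.+ ℚ.- 1/suc 4)))

  Exceptional : ℕ → Set
  Exceptional p = Prime (suc (2 * p)) ⊎ Prime (suc (4 * p))

  module _ {p} (p-prime : Prime p) (7≤p : 7 ≤ p) where

    private
      instance
        p≢0 : NonZero p
        p≢0 = ℕ.>-nonZero (≤-trans (s≤s z≤n) 7≤p)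

        4p≢0 : NonZero (4 * p)
        4p≢0 = m*n≢0 4 p

      small-prime∤p : ∀ {r} → Prime r → r < p → ¬ r ∣ p
      small-prime∤p r-prime r<p r∣p = <-irrefl (prime∣prime⇒≡ r-prime p-prime r∣p) r<p

      2∤p : ¬ 2 ∣ p
      2∤p = small-prime∤p (from-yes (prime? 2)) (≤-trans (from-yes (3 ≤? 7)) 7≤p)

      3∤2p : ¬ 3 ∣ 2 * p
      3∤2p 3∣2p with euclidsLemma 2 p (from-yes (prime? 3)) 3∣2p
      ... | inj₁ 3∣2 = from-no (3 ∣? 2) 3∣2
      ... | inj₂ 3∣p = small-prime∤p (from-yes (prime? 3)) (≤-trans (from-yes (4 ≤? 7)) 7≤p) 3∣p

      2∤1+2n : ∀ n → ¬ 2 ∣ suc (2 * n)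
      2∤1+2n n 2∣1+2n = from-no (2 ∣? 1) (∣m+n∣m⇒∣n (subst (2 ∣_) (+-comm 1 (2 * n)) 2∣1+2n) (divides n (*-comm 2 n)))

      4p≡2*2p : 4 * p ≡ 2 * (2 * p)
      4p≡2*2p = *-assoc 2 2 p

      2∣4p : 2 ∣ 4 * p
      2∣4p = divides (2 * p) (trans 4p≡2*2p (*-comm 2 (2 * p)))

      5<1+mp : ∀ {m} → 2 ≤ m → 5 < suc (m * p)
      5<1+mp 2≤m = s≤s (≤-trans (from-yes (5 ≤? 14)) (*-mono-≤ 2≤m 7≤p))

    divisors-of-4p : ∀ {d} → d ∣ 4 * p → d ≡ 1 ⊎ d ≡ 2 ⊎ d ≡ 4 ⊎ d ≡ p ⊎ d ≡ 2 * p ⊎ d ≡ 4 * p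
    divisors-of-4p {d} d∣4p with p ∣? d
    ... | yes (divides k refl) with divisors-of-4 {k} (*-cancelʳ-∣ p d∣4p)
    ...   | inj₁ refl = inj₂ (inj₂ (inj₂ (inj₁ (+-identityʳ p))))
    ...   | inj₂ (inj₁ refl) = inj₂ (inj₂ (inj₂ (inj₂ (inj₁ refl))))
    ...   | inj₂ (inj₂ refl) = inj₂ (inj₂ (inj₂ (inj₂ (inj₂ refl))))
    divisors-of-4p {d} d∣4p | no p∤d with divisors-of-4 {d} (coprime-divisor d⊥p (subst (d ∣_) (*-comm 4 p) d∣4p))
      where
      d⊥p : Coprime d p
      d⊥p (c∣d , c∣p) with prime⇒irreducible p-prime c∣p
      ... | inj₁ c≡1 = c≡1
      ... | inj₂ refl = contradiction c∣d p∤d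
    ... | inj₁ d≡1 = inj₁ d≡1
    ... | inj₂ (inj₁ d≡2) = inj₂ (inj₁ d≡2)
    ... | inj₂ (inj₂ d≡4) = inj₂ (inj₂ (inj₁ d≡4))

    shifted-prime-divisors : ∀ {ℓ} → Prime ℓ → ℓ ∸ 1 ∣ 4 * p →
                             ℓ ≡ 2 ⊎ ℓ ≡ 3 ⊎ ℓ ≡ 5 ⊎ ℓ ≡ suc (2 * p) ⊎ ℓ ≡ suc (4 * p)
    shifted-prime-divisors {suc ℓ-1} ℓ-prime ℓ-1∣4p with divisors-of-4p ℓ-1∣4p
    ... | inj₁ refl = inj₁ refl
    ... | inj₂ (inj₁ refl) = inj₂ (inj₁ refl)
    ... | inj₂ (inj₂ (inj₁ refl)) = inj₂ (inj₂ (inj₁ refl))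
    ... | inj₂ (inj₂ (inj₂ (inj₁ refl))) =
      contradiction (prime∣prime⇒≡ (from-yes (prime? 2)) ℓ-prime (2∤n⇒2∣1+n 2∤p))
                    (λ 2≡1+p → <⇒≢ (≤-trans (from-yes (2 ≤? 7)) 7≤p) (suc-injective 2≡1+p))
    ... | inj₂ (inj₂ (inj₂ (inj₂ (inj₁ refl)))) = inj₂ (inj₂ (inj₂ (inj₁ refl)))
    ... | inj₂ (inj₂ (inj₂ (inj₂ (inj₂ refl)))) = inj₂ (inj₂ (inj₂ (inj₂ refl)))

    small-shift∣4p : ∀ {ℓ} → ℓ ≡ 2 ⊎ ℓ ≡ 3 ⊎ ℓ ≡ 5 → ℓ ∸ 1 ∣ 4 * p
    small-shift∣4p ℓ∈235 = ∣-trans (shift∣4 ℓ∈235) (divides p (*-comm 4 p))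
      where
      shift∣4 : ∀ {ℓ} → ℓ ≡ 2 ⊎ ℓ ≡ 3 ⊎ ℓ ≡ 5 → ℓ ∸ 1 ∣ 4
      shift∣4 (inj₁ refl) = from-yes (1 ∣? 4)
      shift∣4 (inj₂ (inj₁ refl)) = from-yes (2 ∣? 4)
      shift∣4 (inj₂ (inj₂ refl)) = from-yes (4 ∣? 4)

    toda-3 : Toda p 3
    toda-3 = from-yes (prime? 3) , from-no (2 ∣? 3) , divides (2 * p) (trans 4p≡2*2p (*-comm 2 (2 * p))) ,
             prime-∤⇒gcd≡1 (from-yes (prime? 3)) 3∤2p

    toda-5 : Toda p 5
    toda-5 = from-yes (prime? 5) , from-no (2 ∣? 5) , divides p (*-comm 4 p) ,
             prime-∤⇒gcd≡1 (from-yes (prime? 5)) (small-prime∤p (from-yes (prime? 5)) (≤-trans (from-yes (6 ≤? 7)) 7≤p))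

    toda-1+2p : Prime (suc (2 * p)) → Toda p (suc (2 * p))
    toda-1+2p r-prime = r-prime , 2∤1+2n p , divides 2 4p≡2*2p ,
                        prime-∤⇒gcd≡1 r-prime (>⇒∤ (s≤s (≤-trans (from-yes (2 ≤? 14)) (*-monoʳ-≤ 2 7≤p))))

    toda-1+4p : Prime (suc (4 * p)) → Toda p (suc (4 * p))
    toda-1+4p r-prime = r-prime , subst (λ n → ¬ 2 ∣ suc n) (sym 4p≡2*2p) (2∤1+2n (2 * p)) ,
                        divides 1 (sym (*-identityˡ (4 * p))) ,
                        prime-∤⇒gcd≡1 r-prime (>⇒∤ (s≤s (≤-trans (s≤s z≤n) (*-monoʳ-≤ 4 7≤p))))

    toda-classification : ∀ {q} → Toda p q → q ≡ 3 ⊎ q ≡ 5 ⊎ q ≡ suc (2 * p) ⊎ q ≡ suc (4 * p)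
    toda-classification (q-prime , 2∤q , q-1∣4p , _) with shifted-prime-divisors q-prime q-1∣4p
    ... | inj₁ refl = contradiction ∣-refl 2∤q
    ... | inj₂ q∈ = q∈

    private
      N = 4 * p + 2

      r<N : ∀ {m} → m ≤ 4 → suc (m * p) < N
      r<N {m} m≤4 = subst (_≤ N) (+-comm (m * p) 2) (+-monoˡ-≤ 2 (*-monoˡ-≤ p m≤4))

      3≤t : ∀ r → Toda p r → 5 < r → r < N → 3 ≤ t p
      3≤t r toda-r 5<r r<N =
        ≤-trans (count-accept-≥ (toda? p) toda-r
                  (≤-trans (count-accept-≥ (toda? p) toda-5
                             (≤-trans (count-accept-≥ (toda? p) toda-3 z≤n) (count-mono (toda? p) (n≤1+n 4))))
                           (count-mono (toda? p) 5<r)))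
                (count-mono (toda? p) r<N)

      Q : ℕ → Set
      Q q = q ≡ 3 ⊎ q ≡ 5

      Q? : ∀ q → Dec (Q q)
      Q? q = (q ≟ 3) ⊎-dec (q ≟ 5)

    exceptional⇒3≤t : Exceptional p → 3 ≤ t p
    exceptional⇒3≤t (inj₁ r-prime) = 3≤t (suc (2 * p)) (toda-1+2p r-prime) (5<1+mp ≤-refl) (r<N (from-yes (2 ≤? 4)))
    exceptional⇒3≤t (inj₂ r-prime) = 3≤t (suc (4 * p)) (toda-1+4p r-prime) (5<1+mp (from-yes (2 ≤? 4))) (r<N ≤-refl)

    ¬exceptional⇒t≡2 : ¬ Exceptional p → t p ≡ 2
    ¬exceptional⇒t≡2 ¬exceptional with m≤n⇒∃[o]m+o≡n (+-monoˡ-≤ 2 (≤-trans (from-yes (4 ≤? 28)) (*-monoʳ-≤ 4 7≤p)))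
    ... | k , 6+k≡N = begin
      count (toda? p) N     ≡⟨ count-≐ (toda? p) Q? (only-3-5 , toda-3-5) N ⟩
      count Q? N            ≡⟨ cong (count Q?) 6+k≡N ⟨
      count Q? (6 + k)      ≡⟨ count-reject-range Q? 6 k beyond-5 ⟩
      count Q? 6            ≡⟨⟩
      2                     ∎
      where
      open ≡-Reasoning
      only-3-5 : ∀ {q} → Toda p q → Q q
      only-3-5 toda-q with toda-classification toda-q
      ... | inj₁ q≡3 = inj₁ q≡3
      ... | inj₂ (inj₁ q≡5) = inj₂ q≡5
      ... | inj₂ (inj₂ (inj₁ refl)) = contradiction (inj₁ (proj₁ toda-q)) ¬exceptional
      ... | inj₂ (inj₂ (inj₂ refl)) = contradiction (inj₂ (proj₁ toda-q)) ¬exceptional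
      toda-3-5 : ∀ {q} → Q q → Toda p q
      toda-3-5 (inj₁ refl) = toda-3
      toda-3-5 (inj₂ refl) = toda-5
      beyond-5 : ∀ i → 6 ≤ i → ¬ Q i
      beyond-5 i 6≤i (inj₁ refl) = contradiction 6≤i (from-no (6 ≤? 3))
      beyond-5 i 6≤i (inj₂ refl) = contradiction 6≤i (from-no (6 ≤? 5))

    t≡2⇔¬Exceptional : (t p ≡ 2) ⇔ (¬ Exceptional p)
    t≡2⇔¬Exceptional = mk⇔ (λ t≡2 exceptional → <⇒≢ (exceptional⇒3≤t exceptional) (sym t≡2)) ¬exceptional⇒t≡2

    B+σ-Val≥ : ¬ Exceptional p → ∀ ℓ → Prime ℓ → Val≥ ℓ 0 (B (4 * p) ℚ.+ σ)
    B+σ-Val≥ ¬exceptional (suc ℓ-1) ℓ-prime with ℓ-1 ∣? 4 * p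
    ... | no ℓ-1∤4p = Val≥-+ ℓ-prime (staudt-clausen-nonmultiple ℓ-prime (4 * p) 2∣4p ℓ-1∤4p)
                                 (σ-Val≥ ℓ-prime (ℓ-1∤4p ∘ small-shift∣4p))
    ... | yes ℓ-1∣4p = subst (Val≥ (suc ℓ-1) 0) regroup
                         (Val≥-+ ℓ-prime (staudt-clausen-multiple ℓ-prime (4 * p) 2∣4p ℓ-1∣4p) (σ-1/ℓ-Val≥ ℓ∈235))
      where
      regroup : B (4 * p) ℚ.+ 1/suc ℓ-1 ℚ.+ (σ ℚ.+ ℚ.- 1/suc ℓ-1) ≡ B (4 * p) ℚ.+ σ
      regroup = solve 3 (λ b i s → b :+ i :+ (s :+ :- i) := b :+ s) refl (B (4 * p)) (1/suc ℓ-1) σ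
      ℓ∈235 : suc ℓ-1 ≡ 2 ⊎ suc ℓ-1 ≡ 3 ⊎ suc ℓ-1 ≡ 5
      ℓ∈235 with shifted-prime-divisors ℓ-prime ℓ-1∣4p
      ... | inj₁ ℓ≡2 = inj₁ ℓ≡2
      ... | inj₂ (inj₁ ℓ≡3) = inj₂ (inj₁ ℓ≡3)
      ... | inj₂ (inj₂ (inj₁ ℓ≡5)) = inj₂ (inj₂ ℓ≡5)
      ... | inj₂ (inj₂ (inj₂ (inj₁ refl))) = contradiction (inj₁ ℓ-prime) ¬exceptional
      ... | inj₂ (inj₂ (inj₂ (inj₂ refl))) = contradiction (inj₂ ℓ-prime) ¬exceptional

    ¬exceptional⇒D≡30 : ¬ Exceptional p → D (4 * p) ≡ 30
    ¬exceptional⇒D≡30 ¬exceptional = begin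
      ↧ₙ B (4 * p)
        ≡⟨ cong ↧ₙ_ (solve 2 (λ b s → b := b :+ s :+ :- s) refl (B (4 * p)) σ) ⟩
      ↧ₙ (y ℚ.+ ℚ.- σ)
        ≡⟨ cong (λ x → ↧ₙ (x ℚ.+ ℚ.- σ)) (integral-everywhere⇒integer y (B+σ-Val≥ ¬exceptional)) ⟩
      ↧ₙ (fromℤ (ℚ.↥ y) ℚ.+ ℚ.- σ)
        ≡⟨ ↧ₙ-fromℤ-+ (ℚ.↥ y) (ℚ.- σ) ⟩
      ↧ₙ (ℚ.- σ)
        ≡⟨⟩
      30                                    ∎
      where
      open ≡-Reasoning
      y = B (4 * p) ℚ.+ σ

    private
      large-shifted-prime⇒D≢30 : ∀ {r-1} → Prime (suc r-1) → r-1 ∣ 4 * p → 5 < suc r-1 → D (4 * p) ≢ 30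
      large-shifted-prime⇒D≢30 {r-1} r-prime r-1∣4p 5<r D≡30 =
        ¬Val≥-1/q r-prime (subst (Val≥ (suc r-1) 0) cancel
          (Val≥-+ r-prime (staudt-clausen-multiple r-prime (4 * p) 2∣4p r-1∣4p) (Val≥-neg r-prime B-integral)))
        where
        cancel : B (4 * p) ℚ.+ 1/suc r-1 ℚ.+ ℚ.- B (4 * p) ≡ 1/suc r-1
        cancel = solve 2 (λ b i → b :+ i :+ :- b := i) refl (B (4 * p)) (1/suc r-1)
        ≤5 : ∀ {ℓ} → ℓ ≡ 2 ⊎ ℓ ≡ 3 ⊎ ℓ ≡ 5 → ℓ ≤ 5
        ≤5 (inj₁ refl) = from-yes (2 ≤? 5)
        ≤5 (inj₂ (inj₁ refl)) = from-yes (3 ≤? 5)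
        ≤5 (inj₂ (inj₂ refl)) = ≤-refl
        B-integral : Val≥ (suc r-1) 0 (B (4 * p))
        B-integral = ∤denominator⇒Val≥ λ r∣D → <⇒≱ 5<r (≤5 (prime∣30 r-prime (subst (suc r-1 ∣_) D≡30 r∣D)))

    exceptional⇒D≢30 : Exceptional p → D (4 * p) ≢ 30
    exceptional⇒D≢30 (inj₁ r-prime) = large-shifted-prime⇒D≢30 r-prime (divides 2 4p≡2*2p) (5<1+mp ≤-refl)
    exceptional⇒D≢30 (inj₂ r-prime) = large-shifted-prime⇒D≢30 r-prime ∣-refl (5<1+mp (from-yes (2 ≤? 4)))

    D≡30⇔¬Exceptional : (D (4 * p) ≡ 30) ⇔ (¬ Exceptional p)
    D≡30⇔¬Exceptional = mk⇔ (λ D≡30 exceptional → exceptional⇒D≢30 exceptional D≡30) ¬exceptional⇒D≡30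

open import Data.Nat.Base using (ℕ; suc; _*_; z≤n; s≤s)
open import Data.Nat.Primality using (Prime; prime?)
open import Function.Bundles using (_⇔_; mk⇔)
open import Function.Construct.Composition using (_⇔-∘_)
open import Function.Construct.Symmetry using (⇔-sym)
open import Relation.Nullary.Decidable.Core using (from-no)
open import Relation.Nullary.Negation using (¬_; contradiction)
open import Relation.Binary.PropositionalEquality using (_≡_; refl)
open import Defs using (t; D)
open FourTimesPrime using (t≡2⇔¬Exceptional; D≡30⇔¬Exceptional)

proposition5p3 : (p : ℕ) → Prime p → ¬ (p ≡ 5) → (t p ≡ 2) ⇔ (D (4 * p) ≡ 30)
proposition5p3 2 _ _ = mk⇔ (λ _ → refl) (λ _ → refl)
proposition5p3 3 _ _ = mk⇔ (λ ()) (λ ())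
proposition5p3 4 4-prime _ = contradiction 4-prime (from-no (prime? 4))
proposition5p3 5 _ p≢5 = contradiction refl p≢5
proposition5p3 6 6-prime _ = contradiction 6-prime (from-no (prime? 6))
proposition5p3 p@(suc (suc (suc (suc (suc (suc (suc _))))))) p-prime _ =
  ⇔-sym (D≡30⇔¬Exceptional p-prime 7≤p) ⇔-∘ t≡2⇔¬Exceptional p-prime 7≤p
  where 7≤p = s≤s (s≤s (s≤s (s≤s (s≤s (s≤s (s≤s z≤n))))))
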